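{- Let $T$ be an unrooted binary phylogenetic $X$-tree and $U$ a $3$-cuttable unrooted binary phylogenetic network on $X$ with $|X|>3$. Suppose $U$ has leaves $x,y,z$ and a path $P=(v_1,v_2,v_3,v_4)$ such that $\{v_2,x\},\{v_3,y\},\{v_4,z\}$ are cut-edges of $U$ and no edge joining two vertices of $P$ is a cut-edge, and suppose $T$ has a pendant subtree with leaf set $\{x,y,z\}$ in which $\{x,y\}$ is a cherry. Let $U'$ be obtained from $U$ by eliminating the edge $\{v_1,v_2\}$. Then $U$ displays $T$ if and only if $U'$ displays $T$.
   Context: An unrooted binary phylogenetic network on a non-empty finite set $X$ is a simple connected undirected graph whose internal vertices have degree $3$ and whose degree-$1$ vertices (leaves) are bijectively labeled by $X$; a tree such network is an unrooted binary phylogenetic $X$-tree. A cut-edge is an edge whose deletion disconnects the graph. $U$ is $3$-cuttable if every cycle contains a path of at least $3$ vertices each incident to a cut-edge. A pendant subtree of $T$ is a subtree that can be detached from $T$ by deleting a single edge; two leaves form a cherry if they are adjacent to a common vertex. Eliminating a non-cut-edge means deleting it and suppressing the two resulting degree-$2$ vertices. $U$ displays $T$ if some subgraph of $U$ is a subdivision of $T$. -}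

module Defs where

open import Data.Nat using (ℕ; zero; suc; _+_)
open import Data.Nat.DivMod using (_%_; m%n<n)
open import Data.Bool using (Bool; true; false; _∧_; _∨_; not; if_then_else_)
open import Data.Fin using (Fin; toℕ; fromℕ<; _≟_)
open import Data.Fin.Properties using ()
open import Data.List using (List; []; _∷_; _++_; [_]; reverse; map; allFin)
open import Data.Nat.ListAction using (sum)
open import Data.Unit using (⊤)
open import Data.List.Membership.Propositional using (_∈_)
open import Data.List.Relation.Unary.Unique.Propositional using (Unique)
open import Data.Product using (Σ; ∃; _×_; _,_)
open import Data.Sum using (_⊎_)
open import Data.Empty using (⊥)
open import Relation.Nullary using (¬_; Dec; yes; no)
open import Relation.Nullary.Decidable using (⌊_⌋)
open import Relation.Binary.PropositionalEquality using (_≡_; _≢_)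
open import Function using (Injective)

record LabGraph (m : ℕ) : Set where
  field
    n    : ℕ
    adj  : Fin n → Fin n → Bool
    leaf : Fin m → Fin n

open LabGraph public

Adj : ∀ {n} → (Fin n → Fin n → Bool) → Fin n → Fin n → Set
Adj a u v = a u v ≡ true

deg : ∀ {n} → (Fin n → Fin n → Bool) → Fin n → ℕ
deg {n} a v = sum (map (λ w → if a v w then 1 else 0) (allFin n))

data Reach {n} (a : Fin n → Fin n → Bool) : Fin n → Fin n → Set where
  here : ∀ {u} → Reach a u u
  step : ∀ {u v w} → Adj a u v → Reach a v w → Reach a u w

Connected : ∀ {n} → (Fin n → Fin n → Bool) → Set
Connected a = ∀ u v → Reach a u v

deleteEdge : ∀ {n} → (Fin n → Fin n → Bool) → Fin n → Fin n → Fin n → Fin n → Bool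
deleteEdge a u v p q =
  a p q ∧ not ((⌊ p ≟ u ⌋ ∧ ⌊ q ≟ v ⌋) ∨ (⌊ p ≟ v ⌋ ∧ ⌊ q ≟ u ⌋))

CutEdge : ∀ {m} (G : LabGraph m) → Fin (n G) → Fin (n G) → Set
CutEdge G u v = Adj (adj G) u v × ¬ Connected (deleteEdge (adj G) u v)

IncCut : ∀ {m} (G : LabGraph m) → Fin (n G) → Set
IncCut G v = ∃ λ w → CutEdge G v w

record IsNetwork {m : ℕ} (G : LabGraph m) : Set where
  field
    X-nonempty : Fin m
    symm       : ∀ u v → adj G u v ≡ adj G v u
    irrefl     : ∀ u → adj G u u ≡ false
    connected  : Connected (adj G)
    degrees    : ∀ v → deg (adj G) v ≡ 1 ⊎ deg (adj G) v ≡ 3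
    leaf-inj   : Injective _≡_ _≡_ (leaf G)
    leaf-deg   : ∀ ℓ → deg (adj G) (leaf G ℓ) ≡ 1
    deg1-leaf  : ∀ v → deg (adj G) v ≡ 1 → ∃ λ ℓ → leaf G ℓ ≡ v

next : ∀ {k} → Fin (suc k) → Fin (suc k)
next {k} i = fromℕ< (m%n<n (suc (toℕ i)) (suc k))

record Cycle {m : ℕ} (G : LabGraph m) : Set where
  field
    k     : ℕ
    c     : Fin (suc (suc (suc k))) → Fin (n G)
    c-inj : Injective _≡_ _≡_ c
    c-adj : ∀ i → Adj (adj G) (c i) (c (next i))

open Cycle public

ThreeCuttable : ∀ {m} (G : LabGraph m) → Set
ThreeCuttable G = (C : Cycle G) → ∃ λ i →
  IncCut G (c C i) × IncCut G (c C (next i)) × IncCut G (c C (next (next i)))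

IsTree : ∀ {m} (G : LabGraph m) → Set
IsTree G = IsNetwork G × ¬ Cycle G

-- Display: some subgraph of U is a subdivision of T (respecting labels).

IsWalk : ∀ {n} → (Fin n → Fin n → Bool) → List (Fin n) → Set
IsWalk a []           = ⊤
IsWalk a (u ∷ [])     = ⊤
IsWalk a (u ∷ v ∷ vs) = Adj a u v × IsWalk a (v ∷ vs)

SameEdge : ∀ {p} → Fin p → Fin p → Fin p → Fin p → Set
SameEdge a b c d = (a ≡ c × b ≡ d) ⊎ (a ≡ d × b ≡ c)

record Embedding {m : ℕ} (T U : LabGraph m) : Set where
  field
    φ        : Fin (n T) → Fin (n U)
    φ-inj    : Injective _≡_ _≡_ φ
    φ-leaf   : ∀ ℓ → φ (leaf T ℓ) ≡ leaf U ℓ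
    route    : (a b : Fin (n T)) → Adj (adj T) a b → List (Fin (n U))
    route-sym : ∀ a b (h : Adj (adj T) a b) (h' : Adj (adj T) b a) →
                route b a h' ≡ reverse (route a b h)
    route-path : ∀ a b (h : Adj (adj T) a b) →
                 IsWalk (adj U) (φ a ∷ route a b h ++ [ φ b ])
               × Unique (φ a ∷ route a b h ++ [ φ b ])
    route-avoid : ∀ a b (h : Adj (adj T) a b) w → w ∈ route a b h →
                  ∀ t → φ t ≢ w
    route-disj : ∀ a b c d (h : Adj (adj T) a b) (h' : Adj (adj T) c d) →
                 ¬ SameEdge a b c d →
                 ∀ w → w ∈ route a b h → w ∈ route c d h' → ⊥

Displays : ∀ {m} (U T : LabGraph m) → Set
Displays U T = Embedding T U

PendantCherry : ∀ {m} (T : LabGraph m) → Fin m → Fin m → Fin m → Set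
PendantCherry T x y z =
  (∃ λ u → ∃ λ w → Adj (adj T) u w ×
     (∀ ℓ → (Reach (deleteEdge (adj T) u w) w (leaf T ℓ) → (ℓ ≡ x ⊎ ℓ ≡ y ⊎ ℓ ≡ z))
          × ((ℓ ≡ x ⊎ ℓ ≡ y ⊎ ℓ ≡ z) → Reach (deleteEdge (adj T) u w) w (leaf T ℓ))))
  × (∃ λ c → Adj (adj T) c (leaf T x) × Adj (adj T) c (leaf T y))

-- U' is obtained from U by eliminating the edge {u,v}: delete it and
-- suppress the two resulting degree-2 vertices u and v.  U' is given up to
-- isomorphism: ι identifies the vertices of U' with the vertices of U other
-- than u and v; two vertices of U' are adjacent iff they are adjacent in U,
-- or they are the two neighbours of u other than v, or the two neighbours
-- of v other than u.

OtherNbrs : ∀ {m} (U : LabGraph m) → Fin (n U) → Fin (n U) → Fin (n U) → Fin (n U) → Set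
OtherNbrs U u v p q =
  Adj (adj U) u p × Adj (adj U) u q × p ≢ q × p ≢ v × q ≢ v

record Eliminates {m : ℕ} (U : LabGraph m) (u v : Fin (n U)) (U' : LabGraph m) : Set where
  field
    ι        : Fin (n U') → Fin (n U)
    ι-inj    : Injective _≡_ _≡_ ι
    ι-range  : ∀ w → w ≢ u → w ≢ v → ∃ λ a → ι a ≡ w
    ι-avoid  : ∀ a → ι a ≢ u × ι a ≢ v
    ι-leaf   : ∀ ℓ → ι (leaf U' ℓ) ≡ leaf U ℓ
    ι-adj    : ∀ a b → Adj (adj U') a b →
                 Adj (adj U) (ι a) (ι b) ⊎ OtherNbrs U u v (ι a) (ι b) ⊎ OtherNbrs U v u (ι a) (ι b)
    ι-adj⁻   : ∀ a b →
                 (Adj (adj U) (ι a) (ι b) ⊎ OtherNbrs U u v (ι a) (ι b) ⊎ OtherNbrs U v u (ι a) (ι b)) →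
                 Adj (adj U') a b

-- An embedding of T into U′ becomes one into U by putting P₀ or P₁ back on the U′-edges that
-- replaced them. Conversely, an embedding into U none of whose paths uses the edge {P₀,P₁} has no
-- vertex of T at P₀ or P₁ (a branch vertex needs all three edges at its image), so suppressing P₀
-- and P₁ gives an embedding into U′; it remains to find such an embedding.
-- In T, the pendant subtree consists of a cherry vertex c adjacent to x, y and a stem vertex d
-- adjacent to c and z; in U, the leaves x, y, z hang off P₁, P₂, P₃. The path of the edge x–c
-- leaves x through P₁. Either it continues from P₁, necessarily to P₂, and then the edge {P₀,P₁}
-- is unused (going on to P₀ is impossible: the path from y then forces c onto P₂, and c's path back
-- to x would have to reach P₁ directly); or c sits at P₁, the path of c–y is just c, P₂, y, and
-- moving c to P₂ and d to P₃ frees P₀ and P₁.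

module Submission where

open import Defs
open import Axiom.UniquenessOfIdentityProofs using (module Decidable⇒UIP)
open import Data.Bool using (Bool; true; false; _∧_; not; if_then_else_)
import Data.Bool as Bool
open import Data.Bool.Properties using (∧-identityʳ)
open import Data.Empty using (⊥; ⊥-elim)
open import Data.Fin as Fin using (Fin; zero; suc; toℕ; _≟_)
open import Data.Fin.Properties using (any?; toℕ-fromℕ<; toℕ-injective; toℕ<n; <-asym; <-cmp)
open import Data.List using (List; []; _∷_; _++_; [_]; length; lookup; drop; reverse; map; filter; allFin)
open import Data.List.Membership.Propositional using (_∈_; _∉_)
open import Data.List.Membership.Propositional.Properties
  using (∈-++⁺ˡ; ∈-++⁺ʳ; ∈-++⁻; ∈-∃++; ∈-filter⁺; ∈-filter⁻; ∈-allFin; ∈-lookup)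
open import Data.List.Properties
  using (length-++-sucʳ; unfold-reverse; ++-assoc; length-tabulate; reverse-involutive; reverse-++)
open import Data.List.Relation.Binary.Disjoint.Propositional using (Disjoint)
open import Data.List.Relation.Binary.Subset.Propositional using (_⊆_)
open import Data.List.Relation.Unary.All as All using ([]; _∷_)
open import Data.List.Relation.Unary.All.Properties using (¬Any⇒All¬)
open import Data.List.Relation.Unary.AllPairs using ([]; _∷_)
open import Data.List.Relation.Unary.Any as Any using (here; there)
import Data.List.Relation.Unary.Any.Properties as Anyₚ
open import Data.List.Relation.Unary.Unique.Propositional using (Unique)
import Data.List.Relation.Unary.Unique.Propositional.Properties as Unique
open import Data.Nat using (ℕ; zero; suc; _+_; _≤_; _<_; _<?_; z≤n; s≤s)
open import Data.Nat.DivMod using (_%_; m%n<n; m<n⇒m%n≡m; n%n≡0)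
open import Data.Nat.ListAction using (sum)
open import Data.Nat.Properties
  using (≤-trans; ≤-reflexive; <-irrefl; <⇒≱; <-≤-trans; +-suc; n<1+n; m≤m+n; suc-injective; ≤-antisym; ≤-pred; ≰⇒>; ≮⇒≥)
open import Data.Product using (Σ; ∃; _×_; _,_; proj₁; proj₂)
open import Data.Sum using (_⊎_; inj₁; inj₂; [_,_]′)
open import Data.Unit using (⊤; tt)
open import Function using (Injective; _⇔_; mk⇔; _∘_; case_of_)
open import Relation.Binary.Definitions using (tri<; tri≈; tri>)
open import Relation.Binary.PropositionalEquality
  using (_≡_; _≢_; refl; sym; trans; cong; subst; module ≡-Reasoning)
open import Relation.Nullary using (¬_; Dec; yes; no; does)
open import Relation.Nullary.Decidable using (_×-dec_; _⊎-dec_; ¬?; isYes≗does)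


module _ {A : Set} where

  Unique-∷ : ∀ {x : A} {xs} → x ∉ xs → Unique xs → Unique (x ∷ xs)
  Unique-∷ x∉xs u = ¬Any⇒All¬ _ x∉xs ∷ u

  Unique-head : ∀ {x : A} {xs} → Unique (x ∷ xs) → x ∉ xs
  Unique-head = Unique.Unique[x∷xs]⇒x∉xs

  Unique-tail : ∀ {x : A} {xs} → Unique (x ∷ xs) → Unique xs
  Unique-tail (_ ∷ u) = u

  Unique-++⁻ˡ : ∀ (xs : List A) {ys} → Unique (xs ++ ys) → Unique xs
  Unique-++⁻ˡ []       _ = []
  Unique-++⁻ˡ (x ∷ xs) u =
    Unique-∷ (λ p → Unique-head u (∈-++⁺ˡ p)) (Unique-++⁻ˡ xs (Unique-tail u))

  Unique-++⁻ʳ : ∀ (xs : List A) {ys} → Unique (xs ++ ys) → Unique ys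
  Unique-++⁻ʳ []       u = u
  Unique-++⁻ʳ (x ∷ xs) u = Unique-++⁻ʳ xs (Unique-tail u)

  Unique-++⇒Disjoint : ∀ (xs : List A) {ys} → Unique (xs ++ ys) → Disjoint xs ys
  Unique-++⇒Disjoint (x ∷ xs) u (here refl , q) = Unique-head u (∈-++⁺ʳ xs q)
  Unique-++⇒Disjoint (x ∷ xs) u (there p , q)   = Unique-++⇒Disjoint xs (Unique-tail u) (p , q)

  Unique-∷ʳ : ∀ (xs : List A) {y} → Unique xs → y ∉ xs → Unique (xs ++ [ y ])
  Unique-∷ʳ xs u y∉xs = Unique.++⁺ u (Unique-∷ (λ ()) []) λ { (p , here refl) → y∉xs p }

  Unique-reverse : ∀ (xs : List A) → Unique xs → Unique (reverse xs)
  Unique-reverse []       u = u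
  Unique-reverse (x ∷ xs) u rewrite unfold-reverse x xs =
    Unique-∷ʳ (reverse xs) (Unique-reverse xs (Unique-tail u)) (Unique-head u ∘ Anyₚ.reverse⁻)

  Unique⇒length≤ : ∀ {xs ys : List A} → Unique xs → xs ⊆ ys → length xs ≤ length ys
  Unique⇒length≤ {[]}     _          _     = z≤n
  Unique⇒length≤ {x ∷ xs} (x≢xs ∷ u) xs⊆ys with ∈-∃++ (xs⊆ys (here refl))
  ... | pre , post , refl =
    ≤-trans (s≤s (Unique⇒length≤ u xs⊆pre++post)) (≤-reflexive (sym (length-++-sucʳ pre x post)))
    where
      xs⊆pre++post : xs ⊆ pre ++ post
      xs⊆pre++post {v} v∈xs with ∈-++⁻ pre (xs⊆ys (there v∈xs))
      ... | inj₁ p           = ∈-++⁺ˡ p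
      ... | inj₂ (here refl) = ⊥-elim (All.lookup x≢xs v∈xs refl)
      ... | inj₂ (there p)   = ∈-++⁺ʳ pre p

  lookup-injective : ∀ (xs : List A) → Unique xs → ∀ i j → lookup xs i ≡ lookup xs j → i ≡ j
  lookup-injective (x ∷ xs) u zero    zero    e = refl
  lookup-injective (x ∷ xs) u zero    (suc j) e = ⊥-elim (Unique-head u (subst (_∈ xs) (sym e) (∈-lookup j)))
  lookup-injective (x ∷ xs) u (suc i) zero    e = ⊥-elim (Unique-head u (subst (_∈ xs) e (∈-lookup i)))
  lookup-injective (x ∷ xs) u (suc i) (suc j) e = cong suc (lookup-injective xs (Unique-tail u) i j e)

  ∈-enclosed⁻ : ∀ {x y w : A} r → w ∈ x ∷ r ++ [ y ] → w ≡ x ⊎ w ∈ r ⊎ w ≡ y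
  ∈-enclosed⁻ r (here e)  = inj₁ e
  ∈-enclosed⁻ r (there p) with ∈-++⁻ r p
  ... | inj₁ q        = inj₂ (inj₁ q)
  ... | inj₂ (here e) = inj₂ (inj₂ e)

  reverse-path : ∀ (x : A) r y → reverse (y ∷ r ++ [ x ]) ≡ x ∷ reverse r ++ [ y ]
  reverse-path x r y = begin
    reverse (y ∷ r ++ [ x ])      ≡⟨ unfold-reverse y (r ++ [ x ]) ⟩
    reverse (r ++ [ x ]) ++ [ y ] ≡⟨ cong (_++ [ y ]) (reverse-++ r [ x ]) ⟩
    x ∷ reverse r ++ [ y ]        ∎
    where open ≡-Reasoning

  headOr : List A → A → A
  headOr []      z = z
  headOr (w ∷ _) z = w

  headOr-cases : ∀ R g → headOr R g ≡ g ⊎ headOr R g ∈ R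
  headOr-cases []      g = inj₁ refl
  headOr-cases (x ∷ R) g = inj₂ (here refl)

  headOr-view : ∀ R g {p} → headOr R g ≡ p → (R ≡ [] × g ≡ p) ⊎ (∃ λ r → R ≡ p ∷ r)
  headOr-view []      g e    = inj₁ (refl , e)
  headOr-view (x ∷ R) g refl = inj₂ (R , refl)

  headOr-∈ : ∀ R g rest → headOr R g ∈ R ++ g ∷ rest
  headOr-∈ []      g rest = here refl
  headOr-∈ (x ∷ R) g rest = here refl

  headOr-∈-nonempty : ∀ {x} R g → x ∈ R → headOr R g ∈ R
  headOr-∈-nonempty (w ∷ R) g _ = here refl

  headOr-∷ʳ : ∀ R g q → headOr (R ++ [ g ]) q ≡ headOr R g
  headOr-∷ʳ []      g q = refl
  headOr-∷ʳ (x ∷ R) g q = refl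

  headOr-∷-drop : ∀ R g → R ++ [ g ] ≡ headOr R g ∷ drop 1 (R ++ [ g ])
  headOr-∷-drop []      g = refl
  headOr-∷-drop (x ∷ R) g = refl

  first≡last⇒singleton : ∀ r {z z′ p} → Unique r → headOr r z ≡ p → headOr (reverse r) z′ ≡ p → z ≢ p →
    r ≡ [ p ]
  first≡last⇒singleton []           _ first _    z≢p = ⊥-elim (z≢p first)
  first≡last⇒singleton (w ∷ [])     _ refl  _    _   = refl
  first≡last⇒singleton (w ∷ w′ ∷ r) {z′ = z′} u refl last _ =
    ⊥-elim (Unique-head u (Anyₚ.reverse⁻ (subst (_∈ reverse (w′ ∷ r)) last-is-w last∈)))
    where
      last∈ : headOr (reverse r) w′ ∈ reverse (w′ ∷ r)
      last∈ = subst (headOr (reverse r) w′ ∈_) (sym (unfold-reverse w′ r)) (headOr-∈ (reverse r) w′ [])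
      last-is-w : headOr (reverse r) w′ ≡ w
      last-is-w = begin
        headOr (reverse r) w′                 ≡⟨ sym (headOr-∷ʳ (reverse r) w′ w) ⟩
        headOr (reverse r ++ [ w′ ]) w        ≡⟨ cong (λ l → headOr l w) (sym (unfold-reverse w′ r)) ⟩
        headOr (reverse (w′ ∷ r)) w           ≡⟨ sym (headOr-∷ʳ (reverse (w′ ∷ r)) w z′) ⟩
        headOr (reverse (w′ ∷ r) ++ [ w ]) z′ ≡⟨ cong (λ l → headOr l z′) (sym (unfold-reverse w (w′ ∷ r))) ⟩
        headOr (reverse (w ∷ w′ ∷ r)) z′      ≡⟨ last ⟩
        w                                     ∎
        where open ≡-Reasoning

  lastOf : A → List A → A
  lastOf x []       = x
  lastOf x (y ∷ ys) = lastOf y ys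

  lastOf-++ : ∀ x xs y ys → lastOf x (xs ++ y ∷ ys) ≡ lastOf y ys
  lastOf-++ x []       y ys = refl
  lastOf-++ x (z ∷ xs) y ys = lastOf-++ z xs y ys

  lastOf-∈ : ∀ x ys → lastOf x ys ∈ x ∷ ys
  lastOf-∈ x []       = here refl
  lastOf-∈ x (y ∷ ys) = there (lastOf-∈ y ys)

  NonBacktracking : List A → Set
  NonBacktracking (x ∷ y ∷ z ∷ r) = x ≢ z × NonBacktracking (y ∷ z ∷ r)
  NonBacktracking _               = ⊤

  NonBacktracking-tail : ∀ x xs → NonBacktracking (x ∷ xs) → NonBacktracking xs
  NonBacktracking-tail x []          _       = tt
  NonBacktracking-tail x (_ ∷ [])    _       = tt
  NonBacktracking-tail x (_ ∷ _ ∷ _) (_ , r) = r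

  Unique⇒NonBacktracking : ∀ xs → Unique xs → NonBacktracking xs
  Unique⇒NonBacktracking []              _ = tt
  Unique⇒NonBacktracking (x ∷ [])        _ = tt
  Unique⇒NonBacktracking (x ∷ y ∷ [])    _ = tt
  Unique⇒NonBacktracking (x ∷ y ∷ z ∷ r) u =
    (λ e → Unique-head u (there (here e))) , Unique⇒NonBacktracking (y ∷ z ∷ r) (Unique-tail u)

  NonBacktracking-++ : ∀ xs a b ys → NonBacktracking (xs ++ a ∷ b ∷ []) → NonBacktracking (a ∷ b ∷ ys) →
    NonBacktracking (xs ++ a ∷ b ∷ ys)
  NonBacktracking-++ []                 a b ys _         nb₂ = nb₂
  NonBacktracking-++ (x ∷ [])           a b ys (e , _)   nb₂ = e , nb₂
  NonBacktracking-++ (x ∷ x′ ∷ [])      a b ys (e , nb₁) nb₂ = e , NonBacktracking-++ (x′ ∷ []) a b ys nb₁ nb₂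
  NonBacktracking-++ (x ∷ x′ ∷ x″ ∷ xs) a b ys (e , nb₁) nb₂ =
    e , NonBacktracking-++ (x′ ∷ x″ ∷ xs) a b ys nb₁ nb₂

  pigeonhole₃ : ∀ {p q s₁ s₂ s₃ : A} → s₁ ≢ s₂ → s₁ ≢ s₃ → s₂ ≢ s₃ →
    s₁ ≡ p ⊎ s₁ ≡ q → s₂ ≡ p ⊎ s₂ ≡ q → s₃ ≡ p ⊎ s₃ ≡ q → ⊥
  pigeonhole₃ s₁≢s₂ _     _     (inj₁ x) (inj₁ y) _        = s₁≢s₂ (trans x (sym y))
  pigeonhole₃ s₁≢s₂ _     _     (inj₂ x) (inj₂ y) _        = s₁≢s₂ (trans x (sym y))
  pigeonhole₃ _     s₁≢s₃ _     (inj₁ x) _        (inj₁ z) = s₁≢s₃ (trans x (sym z))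
  pigeonhole₃ _     s₁≢s₃ _     (inj₂ x) _        (inj₂ z) = s₁≢s₃ (trans x (sym z))
  pigeonhole₃ _     _     s₂≢s₃ _        (inj₁ y) (inj₁ z) = s₂≢s₃ (trans y (sym z))
  pigeonhole₃ _     _     s₂≢s₃ _        (inj₂ y) (inj₂ z) = s₂≢s₃ (trans y (sym z))

Unique⇒length≤n : ∀ {k} (L : List (Fin k)) → Unique L → length L ≤ k
Unique⇒length≤n L u = subst (length L ≤_) (length-tabulate (λ i → i)) (Unique⇒length≤ u (λ _ → ∈-allFin _))

true≢false : ∀ {b} → b ≡ true → b ≡ false → ⊥
true≢false refl ()

module _ {A : Set} (b : A → Bool) where

  sum-indicator≡length-filter : ∀ xs →
    sum (map (λ w → if b w then 1 else 0) xs) ≡ length (filter (λ w → b w Bool.≟ true) xs)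
  sum-indicator≡length-filter []       = refl
  sum-indicator≡length-filter (x ∷ xs) with b x
  ... | true  = cong suc (sum-indicator≡length-filter xs)
  ... | false = sum-indicator≡length-filter xs

module _ {n : ℕ} (a : Fin n → Fin n → Bool) where

  adj? : ∀ v w → Dec (Adj a v w)
  adj? v w = a v w Bool.≟ true

  deg≡length-neighbours : ∀ v → deg a v ≡ length (filter (adj? v) (allFin n))
  deg≡length-neighbours v = sum-indicator≡length-filter (a v) (allFin n)

  length≤deg : ∀ v {L} → Unique L → (∀ {w} → w ∈ L → Adj a v w) → length L ≤ deg a v
  length≤deg v u L-adj = subst (_ ≤_) (sym (deg≡length-neighbours v))
    (Unique⇒length≤ u (λ w∈L → ∈-filter⁺ (adj? v) (∈-allFin _) (L-adj w∈L)))

  deg≤length : ∀ v {L} → (∀ {w} → Adj a v w → w ∈ L) → deg a v ≤ length L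
  deg≤length v adj-L = subst (_≤ _) (sym (deg≡length-neighbours v))
    (Unique⇒length≤ (Unique.filter⁺ (adj? v) (Unique.allFin⁺ n))
      (adj-L ∘ proj₂ ∘ ∈-filter⁻ (adj? v) {xs = allFin n}))

  deg≡1⇒adj-unique : ∀ v {p q} → deg a v ≡ 1 → Adj a v p → Adj a v q → p ≡ q
  deg≡1⇒adj-unique v {p} {q} d ap aq with p ≟ q
  ... | yes p≡q = p≡q
  ... | no p≢q  = ⊥-elim (<-irrefl refl (subst (2 ≤_) d (length≤deg v ((p≢q ∷ []) ∷ [] ∷ []) nbr)))
    where
      nbr : ∀ {w} → w ∈ p ∷ q ∷ [] → Adj a v w
      nbr (here refl)         = ap
      nbr (there (here refl)) = aq

  deg≡3⇒adj-cases : ∀ v {p q r} → deg a v ≡ 3 → p ≢ q → p ≢ r → q ≢ r →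
    Adj a v p → Adj a v q → Adj a v r → ∀ {w} → Adj a v w → w ≡ p ⊎ w ≡ q ⊎ w ≡ r
  deg≡3⇒adj-cases v {p} {q} {r} d p≢q p≢r q≢r ap aq ar {w} aw with w ≟ p | w ≟ q | w ≟ r
  ... | yes w≡p | _       | _       = inj₁ w≡p
  ... | no _    | yes w≡q | _       = inj₂ (inj₁ w≡q)
  ... | no _    | no _    | yes w≡r = inj₂ (inj₂ w≡r)
  ... | no w≢p  | no w≢q  | no w≢r  =
    ⊥-elim (<-irrefl refl (subst (4 ≤_) d (length≤deg v distinct nbr)))
    where
      distinct : Unique (p ∷ q ∷ r ∷ w ∷ [])
      distinct = (p≢q ∷ p≢r ∷ (w≢p ∘ sym) ∷ []) ∷ (q≢r ∷ (w≢q ∘ sym) ∷ []) ∷ ((w≢r ∘ sym) ∷ []) ∷ [] ∷ []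
      nbr : ∀ {x} → x ∈ p ∷ q ∷ r ∷ w ∷ [] → Adj a v x
      nbr (here refl)                         = ap
      nbr (there (here refl))                 = aq
      nbr (there (there (here refl)))         = ar
      nbr (there (there (there (here refl)))) = aw

  deg≡3⇒third-neighbour : ∀ v {p q} → deg a v ≡ 3 → Adj a v p → Adj a v q →
    ∃ λ r → Adj a v r × r ≢ p × r ≢ q
  deg≡3⇒third-neighbour v {p} {q} d ap aq
    with any? (λ r → adj? v r ×-dec ¬? (r ≟ p) ×-dec ¬? (r ≟ q))
  ... | yes found = found
  ... | no none   = ⊥-elim (<-irrefl refl (subst (_≤ 2) d (deg≤length v among)))
    where
      among : ∀ {w} → Adj a v w → w ∈ p ∷ q ∷ []
      among {w} aw with w ≟ p | w ≟ q
      ... | yes refl | _        = here refl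
      ... | no _     | yes refl = there (here refl)
      ... | no w≢p   | no w≢q   = ⊥-elim (none (w , aw , w≢p , w≢q))

  deg≡3⇒other-neighbour : ∀ v {p} → deg a v ≡ 3 → Adj a v p → ∃ λ r → Adj a v r × r ≢ p
  deg≡3⇒other-neighbour v d ap with deg≡3⇒third-neighbour v d ap ap
  ... | r , ar , r≢p , _ = r , ar , r≢p

  deg≡3⇒some-neighbour : ∀ v → deg a v ≡ 3 → ∃ λ p → Adj a v p
  deg≡3⇒some-neighbour v d with any? (adj? v)
  ... | yes found = found
  ... | no none with subst (_≤ 0) d (deg≤length v {[]} λ {w} aw → ⊥-elim (none (w , aw)))
  ...   | ()

  deg≡3⇒three-neighbours : ∀ v → deg a v ≡ 3 → ∃ λ p → ∃ λ q → ∃ λ r →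
    Adj a v p × Adj a v q × Adj a v r × p ≢ q × p ≢ r × q ≢ r
  deg≡3⇒three-neighbours v d with deg≡3⇒some-neighbour v d
  ... | p , ap with deg≡3⇒other-neighbour v d ap
  ... | q , aq , q≢p with deg≡3⇒third-neighbour v d ap aq
  ... | r , ar , r≢p , r≢q = p , q , r , ap , aq , ar , q≢p ∘ sym , r≢p ∘ sym , r≢q ∘ sym

  two-neighbours⇒deg≢1 : ∀ v {p q} → p ≢ q → Adj a v p → Adj a v q → deg a v ≢ 1
  two-neighbours⇒deg≢1 v p≢q ap aq d = p≢q (deg≡1⇒adj-unique v d ap aq)

module _ {k : ℕ} {a b c d : Fin k} where

  SameEdge-flipˡ : SameEdge a b c d → SameEdge b a c d
  SameEdge-flipˡ (inj₁ (a≡c , b≡d)) = inj₂ (b≡d , a≡c)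
  SameEdge-flipˡ (inj₂ (a≡d , b≡c)) = inj₁ (b≡c , a≡d)

  SameEdge-flipʳ : SameEdge a b c d → SameEdge a b d c
  SameEdge-flipʳ (inj₁ (a≡c , b≡d)) = inj₂ (a≡c , b≡d)
  SameEdge-flipʳ (inj₂ (a≡d , b≡c)) = inj₁ (a≡d , b≡c)

  SameEdge-sym : SameEdge a b c d → SameEdge c d a b
  SameEdge-sym (inj₁ (a≡c , b≡d)) = inj₁ (sym a≡c , sym b≡d)
  SameEdge-sym (inj₂ (a≡d , b≡c)) = inj₂ (sym b≡c , sym a≡d)

SameEdge-other-end : ∀ {k} {q g g′ u w : Fin k} → u ≢ w → SameEdge q g u w → SameEdge q g′ u w → g ≡ g′
SameEdge-other-end u≢w (inj₁ (_ , e₁)) (inj₁ (_ , e₂)) = trans e₁ (sym e₂)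
SameEdge-other-end u≢w (inj₂ (_ , e₁)) (inj₂ (_ , e₂)) = trans e₁ (sym e₂)
SameEdge-other-end u≢w (inj₁ (e₁ , _)) (inj₂ (e₂ , _)) = ⊥-elim (u≢w (trans (sym e₁) e₂))
SameEdge-other-end u≢w (inj₂ (e₁ , _)) (inj₁ (e₂ , _)) = ⊥-elim (u≢w (trans (sym e₂) e₁))

sameEdge? : ∀ {n} (p q u v : Fin n) → Dec (SameEdge p q u v)
sameEdge? p q u v = (p ≟ u ×-dec q ≟ v) ⊎-dec (p ≟ v ×-dec q ≟ u)

module _ {n : ℕ} (a : Fin n → Fin n → Bool) (u v : Fin n) where

  private
    removes : ∀ {p q} (s? : Dec (SameEdge p q u v)) → SameEdge p q u v → a p q ∧ not (does s?) ≢ true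
    removes {p} {q} (yes _) _ h with a p q | h
    ... | true  | ()
    ... | false | ()
    removes (no ¬s) s _ = ¬s s

    keeps : ∀ {p q} (s? : Dec (SameEdge p q u v)) → Adj a p q → ¬ SameEdge p q u v →
      a p q ∧ not (does s?) ≡ true
    keeps (yes s) _ ¬s = ⊥-elim (¬s s)
    keeps {p} {q} (no _) h _ = trans (∧-identityʳ (a p q)) h

  deleteEdge⇒adj : ∀ {p q} → Adj (deleteEdge a u v) p q → Adj a p q
  deleteEdge⇒adj {p} {q} h with a p q
  ... | true  = refl
  ... | false = h

  deleteEdge≡ : ∀ p q → deleteEdge a u v p q ≡ a p q ∧ not (does (sameEdge? p q u v))
  deleteEdge≡ p q
    rewrite isYes≗does (p ≟ u) | isYes≗does (q ≟ v) | isYes≗does (p ≟ v) | isYes≗does (q ≟ u) = refl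

  deleteEdge-removes : ∀ {p q} → SameEdge p q u v → ¬ Adj (deleteEdge a u v) p q
  deleteEdge-removes {p} {q} s h = removes (sameEdge? p q u v) s (trans (sym (deleteEdge≡ p q)) h)

  deleteEdge-keeps : ∀ {p q} → Adj a p q → ¬ SameEdge p q u v → Adj (deleteEdge a u v) p q
  deleteEdge-keeps {p} {q} h ¬s = trans (deleteEdge≡ p q) (keeps (sameEdge? p q u v) h ¬s)

  adj∖deleteEdge⇒SameEdge : ∀ {p q} → Adj a p q → ¬ Adj (deleteEdge a u v) p q → SameEdge p q u v
  adj∖deleteEdge⇒SameEdge {p} {q} h ¬h with sameEdge? p q u v
  ... | yes s  = s
  ... | no ¬s = ⊥-elim (¬h (deleteEdge-keeps h ¬s))

  deleteEdge-sym : (∀ {p q} → Adj a p q → Adj a q p) →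
    ∀ {p q} → Adj (deleteEdge a u v) p q → Adj (deleteEdge a u v) q p
  deleteEdge-sym a-sym h =
    deleteEdge-keeps (a-sym (deleteEdge⇒adj h)) (λ s → deleteEdge-removes (SameEdge-flipˡ s) h)

deleteEdge-end-neighbours : ∀ {n} (a : Fin n → Fin n → Bool) {u v X Y} → deg a X ≡ 3 → Adj a X Y →
  SameEdge X Y u v → ∃ λ p → ∃ λ q → ∀ {w} → Adj (deleteEdge a u v) X w → w ≡ p ⊎ w ≡ q
deleteEdge-end-neighbours a {u} {v} {X} {Y} X-deg X~Y edge with deg≡3⇒other-neighbour a X X-deg X~Y
... | p , X~p , p≢Y with deg≡3⇒third-neighbour a X X-deg X~Y X~p
... | q , X~q , q≢Y , q≢p = p , q , among
  where
    among : ∀ {w} → Adj (deleteEdge a u v) X w → w ≡ p ⊎ w ≡ q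
    among X~w with deg≡3⇒adj-cases a X X-deg (p≢Y ∘ sym) (q≢Y ∘ sym) (q≢p ∘ sym) X~Y X~p X~q
                     (deleteEdge⇒adj a u v X~w)
    ... | inj₁ refl = ⊥-elim (deleteEdge-removes a u v edge X~w)
    ... | inj₂ r    = r

-- Walks, reachability and cycles

module _ {n : ℕ} (a : Fin n → Fin n → Bool) where

  IsWalk-tail : ∀ {x} xs → IsWalk a (x ∷ xs) → IsWalk a xs
  IsWalk-tail []      _       = tt
  IsWalk-tail (_ ∷ _) (_ , w) = w

  IsWalk-++ : ∀ xs {y} ys → IsWalk a (xs ++ [ y ]) → IsWalk a (y ∷ ys) → IsWalk a (xs ++ y ∷ ys)
  IsWalk-++ []             ys _        w₂ = w₂
  IsWalk-++ (x ∷ [])       ys (e , _)  w₂ = e , w₂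
  IsWalk-++ (x ∷ x′ ∷ xs)  ys (e , w₁) w₂ = e , IsWalk-++ (x′ ∷ xs) ys w₁ w₂

  IsWalk-++⁻ˡ : ∀ xs {y} ys → IsWalk a (xs ++ y ∷ ys) → IsWalk a (xs ++ [ y ])
  IsWalk-++⁻ˡ []            ys _       = tt
  IsWalk-++⁻ˡ (x ∷ [])      ys (e , _) = e , tt
  IsWalk-++⁻ˡ (x ∷ x′ ∷ xs) ys (e , w) = e , IsWalk-++⁻ˡ (x′ ∷ xs) ys w

  IsWalk-++⁻ʳ : ∀ xs {y} ys → IsWalk a (xs ++ y ∷ ys) → IsWalk a (y ∷ ys)
  IsWalk-++⁻ʳ []       ys w = w
  IsWalk-++⁻ʳ (x ∷ xs) ys w = IsWalk-++⁻ʳ xs ys (IsWalk-tail (xs ++ _ ∷ ys) w)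

  IsWalk-reverse : (∀ {p q} → Adj a p q → Adj a q p) → ∀ xs → IsWalk a xs → IsWalk a (reverse xs)
  IsWalk-reverse a-sym []           _       = tt
  IsWalk-reverse a-sym (x ∷ [])     _       = tt
  IsWalk-reverse a-sym (x ∷ y ∷ xs) (e , w) =
    subst (IsWalk a) (sym (reverse-snoc₂ x y xs))
      (IsWalk-++ (reverse xs) [ x ]
        (subst (IsWalk a) (unfold-reverse y xs) (IsWalk-reverse a-sym (y ∷ xs) w))
        (a-sym e , tt))
    where
      reverse-snoc₂ : ∀ (x y : Fin n) xs → reverse (x ∷ y ∷ xs) ≡ reverse xs ++ y ∷ [ x ]
      reverse-snoc₂ x y xs = begin
        reverse (x ∷ y ∷ xs)          ≡⟨ unfold-reverse x (y ∷ xs) ⟩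
        reverse (y ∷ xs) ++ [ x ]     ≡⟨ cong (_++ [ x ]) (unfold-reverse y xs) ⟩
        (reverse xs ++ [ y ]) ++ [ x ] ≡⟨ ++-assoc (reverse xs) [ y ] [ x ] ⟩
        reverse xs ++ y ∷ [ x ]       ∎
        where open ≡-Reasoning

  IsWalk-mono : ∀ {b : Fin n → Fin n → Bool} → (∀ {p q} → Adj a p q → Adj b p q) →
    ∀ xs → IsWalk a xs → IsWalk b xs
  IsWalk-mono a⇒b []           _       = tt
  IsWalk-mono a⇒b (x ∷ [])     _       = tt
  IsWalk-mono a⇒b (x ∷ y ∷ xs) (e , w) = a⇒b e , IsWalk-mono a⇒b (y ∷ xs) w

  IsWalk-deleteEdge : ∀ {u v} xs → IsWalk a xs → (u ∈ xs → v ∈ xs → ⊥) → IsWalk (deleteEdge a u v) xs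
  IsWalk-deleteEdge []           _       _   = tt
  IsWalk-deleteEdge (x ∷ [])     _       _   = tt
  IsWalk-deleteEdge {u} {v} (x ∷ y ∷ xs) (e , w) not-both =
    deleteEdge-keeps a u v e not-this-edge ,
    IsWalk-deleteEdge (y ∷ xs) w (λ p q → not-both (there p) (there q))
    where
      not-this-edge : ¬ SameEdge x y u v
      not-this-edge (inj₁ (refl , refl)) = not-both (here refl) (there (here refl))
      not-this-edge (inj₂ (refl , refl)) = not-both (there (here refl)) (here refl)

  IsWalk-deleteEdge-from : ∀ {u v w} L → IsWalk a (v ∷ w ∷ L) → v ∉ w ∷ L → w ≢ u →
    IsWalk (deleteEdge a u v) (v ∷ w ∷ L)
  IsWalk-deleteEdge-from {u} {v} {w} L (e , wk) v∉ w≢u =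
    deleteEdge-keeps a u v e not-this-edge , IsWalk-deleteEdge (w ∷ L) wk (λ _ v∈ → v∉ v∈)
    where
      not-this-edge : ¬ SameEdge v w u v
      not-this-edge (inj₁ (_ , w≡v)) = v∉ (here (sym w≡v))
      not-this-edge (inj₂ (_ , w≡u)) = w≢u w≡u

  IsWalk-headOr : ∀ x r z → IsWalk a (x ∷ r ++ [ z ]) → Adj a x (headOr r z)
  IsWalk-headOr x []      z w = proj₁ w
  IsWalk-headOr x (y ∷ r) z w = proj₁ w

  Reach-trans : ∀ {s t r} → Reach a s t → Reach a t r → Reach a s r
  Reach-trans here       q = q
  Reach-trans (step h p) q = step h (Reach-trans p q)

  Reach-sym : (∀ {p q} → Adj a p q → Adj a q p) → ∀ {s t} → Reach a s t → Reach a t s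
  Reach-sym a-sym here       = here
  Reach-sym a-sym (step h p) = Reach-trans (Reach-sym a-sym p) (step (a-sym h) here)

  IsWalk⇒Reach : ∀ s L → IsWalk a (s ∷ L) → ∀ {v} → v ∈ s ∷ L → Reach a s v
  IsWalk⇒Reach s L       _       (here refl) = here
  IsWalk⇒Reach s (y ∷ L) (h , w) (there p)   = step h (IsWalk⇒Reach y L w p)

  Reach⇒path : ∀ {s t} → Reach a s t → ∃ λ Q → IsWalk a (s ∷ Q) × Unique (s ∷ Q) × lastOf s Q ≡ t
  Reach⇒path here = [] , tt , [] ∷ [] , refl
  Reach⇒path {s} (step {v = v} h p) with Reach⇒path p
  ... | Q , w , u , e with Any.any? (s ≟_) (v ∷ Q)
  ...   | no s∉  = v ∷ Q , (h , w) , Unique-∷ s∉ u , e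
  ...   | yes s∈ with ∈-∃++ s∈
  ...     | pre , post , eq =
    post ,
    IsWalk-++⁻ʳ pre post (subst (IsWalk a) eq w) ,
    Unique-++⁻ʳ pre (subst Unique eq u) ,
    trans (sym (shortcut pre eq)) e
    where
      shortcut : ∀ pre → v ∷ Q ≡ pre ++ s ∷ post → lastOf v Q ≡ lastOf s post
      shortcut []         refl = refl
      shortcut (z ∷ pre′) refl = lastOf-++ v pre′ s post

  IsWalk⇒Reach-headOr : ∀ R g rest → IsWalk a (R ++ g ∷ rest) → ∀ {v} → v ∈ R ++ g ∷ rest →
    Reach a (headOr R g) v
  IsWalk⇒Reach-headOr []      g rest = IsWalk⇒Reach g rest
  IsWalk⇒Reach-headOr (r ∷ R) g rest = IsWalk⇒Reach r (R ++ g ∷ rest)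

  IsWalk-lookup : ∀ xs y → IsWalk a (xs ++ [ y ]) → ∀ i j → toℕ j ≡ suc (toℕ i) →
    Adj a (lookup xs i) (lookup xs j)
  IsWalk-lookup (x ∷ x′ ∷ xs) y w zero    (suc zero)    e = proj₁ w
  IsWalk-lookup (x ∷ x′ ∷ xs) y w zero    (suc (suc j)) ()
  IsWalk-lookup (x ∷ xs)      y w (suc i) (suc j)       e =
    IsWalk-lookup xs y (IsWalk-tail (xs ++ [ y ]) w) i j (suc-injective e)

  IsWalk-lookup-last : ∀ xs y → IsWalk a (xs ++ [ y ]) → ∀ i → suc (toℕ i) ≡ length xs →
    Adj a (lookup xs i) y
  IsWalk-lookup-last (x ∷ [])     y w zero    e = proj₁ w
  IsWalk-lookup-last (x ∷ x′ ∷ xs) y w zero   ()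
  IsWalk-lookup-last (x ∷ xs)     y w (suc i) e =
    IsWalk-lookup-last xs y (IsWalk-tail (xs ++ [ y ]) w) i (suc-injective e)

closed-walk⇒Cycle : ∀ {m} (G : LabGraph m) xs x₀ x₁ x₂ →
  IsWalk (adj G) ((x₀ ∷ x₁ ∷ x₂ ∷ xs) ++ [ x₀ ]) → Unique (x₀ ∷ x₁ ∷ x₂ ∷ xs) → Cycle G
closed-walk⇒Cycle G xs x₀ x₁ x₂ w u = record
  { k     = length xs
  ; c     = lookup C
  ; c-inj = λ {i} {j} → lookup-injective C u i j
  ; c-adj = consecutive
  }
  where
    C = x₀ ∷ x₁ ∷ x₂ ∷ xs
    N = suc (suc (length xs))
    consecutive : ∀ i → Adj (adj G) (lookup C i) (lookup C (next i))
    consecutive i with toℕ i <? N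
    ... | yes i<N = IsWalk-lookup (adj G) C x₀ w i (next i)
      (trans (toℕ-fromℕ< (m%n<n (suc (toℕ i)) (suc N))) (m<n⇒m%n≡m (s≤s i<N)))
    ... | no i≮N = subst (λ j → Adj (adj G) (lookup C i) (lookup C j)) (sym next-i≡0)
      (IsWalk-lookup-last (adj G) C x₀ w i (≤-antisym (toℕ<n i) (≰⇒> i≮N)))
      where
        next-i≡0 : next i ≡ zero
        next-i≡0 = toℕ-injective (trans (toℕ-fromℕ< (m%n<n (suc (toℕ i)) (suc N)))
          (subst (λ t → suc t % suc N ≡ 0) (sym (≤-antisym (≤-pred (toℕ<n i)) (≮⇒≥ i≮N))) (n%n≡0 (suc N))))

-- Networks and trees

module NetworkProperties {m : ℕ} {G : LabGraph m} (N : IsNetwork G) where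

  open IsNetwork N

  adj-sym : ∀ {p q} → Adj (adj G) p q → Adj (adj G) q p
  adj-sym {p} {q} h = trans (symm q p) h

  adj-irrefl : ∀ {p} → ¬ Adj (adj G) p p
  adj-irrefl {p} h with trans (sym h) (irrefl p)
  ... | ()

  adj⇒≢ : ∀ {p q} → Adj (adj G) p q → p ≢ q
  adj⇒≢ h refl = adj-irrefl h

  leaf-≢ : ∀ {ℓ ℓ′} → ℓ ≢ ℓ′ → leaf G ℓ ≢ leaf G ℓ′
  leaf-≢ ℓ≢ℓ′ e = ℓ≢ℓ′ (leaf-inj e)

  leaf-adj-unique : ∀ ℓ {p q} → Adj (adj G) (leaf G ℓ) p → Adj (adj G) (leaf G ℓ) q → p ≡ q
  leaf-adj-unique ℓ = deg≡1⇒adj-unique (adj G) (leaf G ℓ) (leaf-deg ℓ)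

  two-neighbours⇒deg≡3 : ∀ v {p q} → p ≢ q → Adj (adj G) v p → Adj (adj G) v q → deg (adj G) v ≡ 3
  two-neighbours⇒deg≡3 v p≢q hp hq with degrees v
  ... | inj₁ d≡1 = ⊥-elim (two-neighbours⇒deg≢1 (adj G) v p≢q hp hq d≡1)
  ... | inj₂ d≡3 = d≡3

  deg≡3⇒≢leaf : ∀ ℓ {v} → deg (adj G) v ≡ 3 → leaf G ℓ ≢ v
  deg≡3⇒≢leaf ℓ d≡3 refl with trans (sym (leaf-deg ℓ)) d≡3
  ... | ()

pendant-edge⇒CutEdge : ∀ {m} {G : LabGraph m} {p q} → p ≢ q → deg (adj G) p ≡ 1 → Adj (adj G) p q → CutEdge G p q
pendant-edge⇒CutEdge {G = G} {p} {q} p≢q p-leaf p~q = p~q , λ connected → stuck (connected p q)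
  where
    stuck : ¬ Reach (deleteEdge (adj G) p q) p q
    stuck here = p≢q refl
    stuck (step {v = w} p~w _) with deg≡1⇒adj-unique (adj G) p p-leaf p~q (deleteEdge⇒adj (adj G) p q p~w)
    ... | refl = deleteEdge-removes (adj G) p q (inj₁ (refl , refl)) p~w

non-cut-edge⇒deg≡3 : ∀ {m} {G : LabGraph m} → IsNetwork G → ∀ {p q} → p ≢ q → Adj (adj G) p q →
  ¬ CutEdge G p q → deg (adj G) p ≡ 3
non-cut-edge⇒deg≡3 {G = G} N {p} p≢q p~q not-cut with IsNetwork.degrees N p
... | inj₁ p-leaf = ⊥-elim (not-cut (pendant-edge⇒CutEdge {G = G} p≢q p-leaf p~q))
... | inj₂ p-deg  = p-deg

module _ {m : ℕ} (G : LabGraph m) (acyclic : ¬ Cycle G) (loopless : ∀ {v} → ¬ Adj (adj G) v v) where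

  private
    repeated-vertex : ∀ x pre post → IsWalk (adj G) (x ∷ pre ++ x ∷ post) →
      NonBacktracking (x ∷ pre ++ x ∷ post) → Unique (pre ++ x ∷ post) → ⊥
    repeated-vertex x []               post w _  _ = loopless (proj₁ w)
    repeated-vertex x (b ∷ [])         post _ nb _ = proj₁ nb refl
    repeated-vertex x (b₁ ∷ b₂ ∷ pre′) post w _  u = acyclic (closed-walk⇒Cycle G pre′ x b₁ b₂
      (IsWalk-++⁻ˡ (adj G) (x ∷ b₁ ∷ b₂ ∷ pre′) post w)
      (Unique-∷ (λ x∈pre → Unique-++⇒Disjoint (b₁ ∷ b₂ ∷ pre′) u (x∈pre , here refl))
                (Unique-++⁻ˡ (b₁ ∷ b₂ ∷ pre′) u)))

  nonbacktracking-walk⇒Unique : ∀ L → IsWalk (adj G) L → NonBacktracking L → Unique L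
  nonbacktracking-walk⇒Unique []      _ _  = []
  nonbacktracking-walk⇒Unique (x ∷ L) w nb = Unique-∷ x∉L L-unique
    where
      L-unique = nonbacktracking-walk⇒Unique L (IsWalk-tail (adj G) L w) (NonBacktracking-tail x L nb)
      x∉L : x ∉ L
      x∉L x∈L with ∈-∃++ x∈L
      ... | pre , post , eq = repeated-vertex x pre post
        (subst (λ l → IsWalk (adj G) (x ∷ l)) eq w)
        (subst (λ l → NonBacktracking (x ∷ l)) eq nb)
        (subst Unique eq L-unique)

fourth-label : ∀ {m} (x y z : Fin m) → 3 < m → ∃ λ ℓ → ℓ ≢ x × ℓ ≢ y × ℓ ≢ z
fourth-label {m} x y z 3<m with any? (λ ℓ → ¬? (ℓ ≟ x) ×-dec ¬? (ℓ ≟ y) ×-dec ¬? (ℓ ≟ z))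
... | yes found = found
... | no none   =
  ⊥-elim (<⇒≱ 3<m (subst (_≤ 3) (length-tabulate (λ ℓ → ℓ)) (Unique⇒length≤ (Unique.allFin⁺ m) covered)))
  where
    covered : allFin m ⊆ x ∷ y ∷ z ∷ []
    covered {ℓ} _ with ℓ ≟ x | ℓ ≟ y | ℓ ≟ z
    ... | yes refl | _        | _        = here refl
    ... | no _     | yes refl | _        = there (here refl)
    ... | no _     | no _     | yes refl = there (there (here refl))
    ... | no ℓ≢x   | no ℓ≢y   | no ℓ≢z   = ⊥-elim (none (ℓ , ℓ≢x , ℓ≢y , ℓ≢z))

module _ {m : ℕ} {T : LabGraph m} (NT : IsNetwork T) where

  open NetworkProperties NT
  private
    A = adj T

  three-leaves-at-a-vertex⇒three-labels : ∀ {c x y z} → x ≢ y → x ≢ z → y ≢ z →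
    Adj A c (leaf T x) → Adj A c (leaf T y) → Adj A c (leaf T z) → ∀ ℓ → ℓ ≡ x ⊎ ℓ ≡ y ⊎ ℓ ≡ z
  three-leaves-at-a-vertex⇒three-labels {c} {x} {y} {z} x≢y x≢z y≢z c~x c~y c~z ℓ
    = classify (closed (inj₁ refl) (IsNetwork.connected NT c (leaf T ℓ)))
    where
      c-deg : deg A c ≡ 3
      c-deg = two-neighbours⇒deg≡3 c (leaf-≢ x≢y) c~x c~y
      Star : Fin (n T) → Set
      Star v = v ≡ c ⊎ v ≡ leaf T x ⊎ v ≡ leaf T y ⊎ v ≡ leaf T z
      step-closed : ∀ {v v′} → Star v → Adj A v v′ → Star v′
      step-closed (inj₁ refl) h =
        inj₂ (deg≡3⇒adj-cases A c c-deg (leaf-≢ x≢y) (leaf-≢ x≢z) (leaf-≢ y≢z) c~x c~y c~z h)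
      step-closed (inj₂ (inj₁ refl))        h = inj₁ (leaf-adj-unique x h (adj-sym c~x))
      step-closed (inj₂ (inj₂ (inj₁ refl))) h = inj₁ (leaf-adj-unique y h (adj-sym c~y))
      step-closed (inj₂ (inj₂ (inj₂ refl))) h = inj₁ (leaf-adj-unique z h (adj-sym c~z))
      closed : ∀ {v v′} → Star v → Reach A v v′ → Star v′
      closed s here       = s
      closed s (step h r) = closed (step-closed s h) r
      classify : Star (leaf T ℓ) → ℓ ≡ x ⊎ ℓ ≡ y ⊎ ℓ ≡ z
      classify (inj₁ e)               = ⊥-elim (deg≡3⇒≢leaf ℓ c-deg e)
      classify (inj₂ (inj₁ e))        = inj₁ (IsNetwork.leaf-inj NT e)
      classify (inj₂ (inj₂ (inj₁ e))) = inj₂ (inj₁ (IsNetwork.leaf-inj NT e))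
      classify (inj₂ (inj₂ (inj₂ e))) = inj₂ (inj₂ (IsNetwork.leaf-inj NT e))

module _ {m : ℕ} {T : LabGraph m} (NT : IsNetwork T) (acyclic : ¬ Cycle T)
         {u w : Fin (n T)} (u≢w : u ≢ w) where

  open NetworkProperties NT
  private
    A = adj T
    D = deleteEdge A u w

  LeafwardExtension : Fin (n T) → List (Fin (n T)) → Set
  LeafwardExtension q rest = ∃ λ R →
    IsWalk D (R ++ q ∷ rest) × NonBacktracking (R ++ q ∷ rest) × deg A (headOr R q) ≡ 1

  private
    extend : ∀ fuel q p rest → n T < fuel + length (q ∷ p ∷ rest) →
      IsWalk D (q ∷ p ∷ rest) → NonBacktracking (q ∷ p ∷ rest) → LeafwardExtension q (p ∷ rest)
    extend zero q p rest too-long wk nb =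
      ⊥-elim (<-irrefl refl (<-≤-trans too-long (Unique⇒length≤n _
        (nonbacktracking-walk⇒Unique T acyclic adj-irrefl _ (IsWalk-mono D (deleteEdge⇒adj A u w) _ wk) nb))))
    extend (suc fuel) q p rest too-long wk nb with IsNetwork.degrees NT q
    ... | inj₁ q-leaf = [] , wk , nb , q-leaf
    ... | inj₂ q-deg with deg≡3⇒other-neighbour A q q-deg (deleteEdge⇒adj A u w (proj₁ wk))
    ... | g₁ , q~g₁ , g₁≢p with deg≡3⇒third-neighbour A q q-deg (deleteEdge⇒adj A u w (proj₁ wk)) q~g₁
    ... | g₂ , q~g₂ , g₂≢p , g₂≢g₁ = choose (adj? D q g₁) (adj? D q g₂)
      where
        continue : ∀ g → Adj D q g → g ≢ p → LeafwardExtension q (p ∷ rest)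
        continue g q~g g≢p
          with extend fuel g q (p ∷ rest) (subst (n T <_) (sym (+-suc fuel _)) too-long)
                 (deleteEdge-sym A u w adj-sym q~g , wk) (g≢p , nb)
        ... | R , wk′ , nb′ , R-leaf =
          R ++ [ g ] ,
          subst (IsWalk D) (sym (++-assoc R [ g ] _)) wk′ ,
          subst NonBacktracking (sym (++-assoc R [ g ] _)) nb′ ,
          subst (λ v → deg A v ≡ 1) (sym (headOr-∷ʳ R g q)) R-leaf
        choose : Dec (Adj D q g₁) → Dec (Adj D q g₂) → LeafwardExtension q (p ∷ rest)
        choose (yes q~g₁) _          = continue g₁ q~g₁ g₁≢p
        choose (no _)     (yes q~g₂) = continue g₂ q~g₂ g₂≢p
        choose (no ¬q~g₁) (no ¬q~g₂) = ⊥-elim (g₂≢g₁ (SameEdge-other-end u≢w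
          (adj∖deleteEdge⇒SameEdge A u w q~g₂ ¬q~g₂) (adj∖deleteEdge⇒SameEdge A u w q~g₁ ¬q~g₁)))

  extend-to-leaf : ∀ q p rest → IsWalk D (q ∷ p ∷ rest) → NonBacktracking (q ∷ p ∷ rest) →
    LeafwardExtension q (p ∷ rest)
  extend-to-leaf q p rest = extend (suc (n T)) q p rest (<-≤-trans (n<1+n (n T)) (m≤m+n (suc (n T)) _))

record CherryShape {m : ℕ} (T : LabGraph m) (x y z : Fin m) : Set where
  field
    cherry stem : Fin (n T)
    cherry~x    : Adj (adj T) cherry (leaf T x)
    cherry~y    : Adj (adj T) cherry (leaf T y)
    cherry~stem : Adj (adj T) cherry stem
    stem~z      : Adj (adj T) stem (leaf T z)
    stem≢x      : stem ≢ leaf T x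
    stem≢y      : stem ≢ leaf T y

module _ {m : ℕ} {T : LabGraph m} (NT : IsNetwork T) (acyclic : ¬ Cycle T)
         {x y z : Fin m} (x≢y : x ≢ y) (x≢z : x ≢ z) (y≢z : y ≢ z) (3<m : 3 < m)
         {u w : Fin (n T)} (u~w : Adj (adj T) u w)
         (pendant : ∀ ℓ → (Reach (deleteEdge (adj T) u w) w (leaf T ℓ) → ℓ ≡ x ⊎ ℓ ≡ y ⊎ ℓ ≡ z)
                        × (ℓ ≡ x ⊎ ℓ ≡ y ⊎ ℓ ≡ z → Reach (deleteEdge (adj T) u w) w (leaf T ℓ)))
         {c : Fin (n T)} (c~x : Adj (adj T) c (leaf T x)) (c~y : Adj (adj T) c (leaf T y)) where

  open NetworkProperties NT
  private
    A = adj T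
    D = deleteEdge A u w
    lx = leaf T x
    ly = leaf T y
    lz = leaf T z

    u≢w : u ≢ w
    u≢w = adj⇒≢ u~w

    D⇒A : ∀ {p q} → Adj D p q → Adj A p q
    D⇒A = deleteEdge⇒adj A u w

    D-sym : ∀ {p q} → Adj D p q → Adj D q p
    D-sym = deleteEdge-sym A u w adj-sym

    c-deg : deg A c ≡ 3
    c-deg = two-neighbours⇒deg≡3 c (leaf-≢ x≢y) c~x c~y

    third = deg≡3⇒third-neighbour A c c-deg c~x c~y
    d = proj₁ third

    c~d : Adj A c d
    c~d = proj₁ (proj₂ third)

    d≢x : d ≢ lx
    d≢x = proj₁ (proj₂ (proj₂ third))

    d≢y : d ≢ ly
    d≢y = proj₂ (proj₂ (proj₂ third))

    c-neighbours : ∀ {v} → Adj A c v → v ≡ lx ⊎ v ≡ ly ⊎ v ≡ d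
    c-neighbours = deg≡3⇒adj-cases A c c-deg (leaf-≢ x≢y) (d≢x ∘ sym) (d≢y ∘ sym) c~x c~y c~d

    d≢z : d ≢ lz
    d≢z d≡z with fourth-label x y z 3<m
    ... | ℓ , ℓ≢x , ℓ≢y , ℓ≢z
      with three-leaves-at-a-vertex⇒three-labels NT x≢y x≢z y≢z c~x c~y (subst (Adj A c) d≡z c~d) ℓ
    ... | inj₁ ℓ≡x        = ℓ≢x ℓ≡x
    ... | inj₂ (inj₁ ℓ≡y) = ℓ≢y ℓ≡y
    ... | inj₂ (inj₂ ℓ≡z) = ℓ≢z ℓ≡z

    RoutesToLeavesAvoiding : Fin (n T) → Fin (n T) → Set
    RoutesToLeavesAvoiding v g = ∀ ℓ → ℓ ≡ x ⊎ ℓ ≡ y ⊎ ℓ ≡ z →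
      ∃ λ Y → IsWalk A (v ∷ Y) × NonBacktracking (g ∷ v ∷ Y) × leaf T ℓ ∈ Y

    -- The leaf reached from v through g lies in the pendant subtree, so it is one of x, y, z,
    -- and the route back to it from v closes a cycle.
    no-escape : ∀ {v g} → Reach D w v → Adj D v g → RoutesToLeavesAvoiding v g → ⊥
    no-escape {v} {g} w⇝v v~g routes = closes (extend-to-leaf NT acyclic u≢w g v [] (D-sym v~g , tt) tt)
      where
        closes : LeafwardExtension NT acyclic u≢w g (v ∷ []) → ⊥
        closes (R , wk , nb , R-leaf) =
          let (ℓ , ℓ≡head) = IsNetwork.deg1-leaf NT (headOr R g) R-leaf
              w⇝ℓ : Reach D w (leaf T ℓ)
              w⇝ℓ = Reach-trans D w⇝v (subst (Reach D v) (sym ℓ≡head) (Reach-sym D D-sym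
                      (IsWalk⇒Reach-headOr D R g (v ∷ []) wk (∈-++⁺ʳ R (there (here refl))))))
              (Y , wk-Y , nb-Y , ℓ∈Y) = routes ℓ (proj₁ (pendant ℓ) w⇝ℓ)
              walk : IsWalk A ((R ++ [ g ]) ++ v ∷ Y)
              walk = IsWalk-++ A (R ++ [ g ]) Y
                       (subst (IsWalk A) (sym (++-assoc R [ g ] [ v ])) (IsWalk-mono D D⇒A _ wk)) wk-Y
              nonbacktracking : NonBacktracking ((R ++ [ g ]) ++ v ∷ Y)
              nonbacktracking = subst NonBacktracking (sym (++-assoc R [ g ] (v ∷ Y)))
                                  (NonBacktracking-++ R g v Y nb nb-Y)
          in Unique-++⇒Disjoint (R ++ [ g ])
               (nonbacktracking-walk⇒Unique T acyclic adj-irrefl _ walk nonbacktracking)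
               (subst (_∈ R ++ [ g ]) (sym ℓ≡head) (headOr-∈ R g []) , there ℓ∈Y)

    x-reachable : Reach D w lx
    x-reachable = proj₂ (pendant x) (inj₁ refl)

    routes-from-stem : ∀ {g m₃ m₄ Q} → g ≢ c → g ≢ m₃ → IsWalk A (d ∷ m₃ ∷ m₄ ∷ Q) →
      Unique (d ∷ m₃ ∷ m₄ ∷ Q) → lz ∈ m₄ ∷ Q → RoutesToLeavesAvoiding d g
    routes-from-stem g≢c _ _ _ _ ℓ (inj₁ refl) =
      c ∷ lx ∷ [] , (adj-sym c~d , c~x , tt) , (g≢c , d≢x , tt) , there (here refl)
    routes-from-stem g≢c _ _ _ _ ℓ (inj₂ (inj₁ refl)) =
      c ∷ ly ∷ [] , (adj-sym c~d , c~y , tt) , (g≢c , d≢y , tt) , there (here refl)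
    routes-from-stem {m₃ = m₃} {m₄} {Q} _ g≢m₃ wk uq z∈ ℓ (inj₂ (inj₂ refl)) =
      m₃ ∷ m₄ ∷ Q , wk , (g≢m₃ , Unique⇒NonBacktracking _ uq) , there z∈

    routes-after-stem : ∀ {g m₃ m₄ Q} → g ≢ d → g ≢ m₄ → m₃ ≢ c → Adj A d m₃ → IsWalk A (m₃ ∷ m₄ ∷ Q) →
      Unique (m₃ ∷ m₄ ∷ Q) → lz ∈ m₄ ∷ Q → RoutesToLeavesAvoiding m₃ g
    routes-after-stem g≢d _ m₃≢c d~m₃ _ _ _ ℓ (inj₁ refl) =
      d ∷ c ∷ lx ∷ [] , (adj-sym d~m₃ , adj-sym c~d , c~x , tt) , (g≢d , m₃≢c , d≢x , tt) , there (there (here refl))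
    routes-after-stem g≢d _ m₃≢c d~m₃ _ _ _ ℓ (inj₂ (inj₁ refl)) =
      d ∷ c ∷ ly ∷ [] , (adj-sym d~m₃ , adj-sym c~d , c~y , tt) , (g≢d , m₃≢c , d≢y , tt) , there (there (here refl))
    routes-after-stem {m₄ = m₄} {Q} _ g≢m₄ _ _ wk uq z∈ ℓ (inj₂ (inj₂ refl)) =
      m₄ ∷ Q , wk , (g≢m₄ , Unique⇒NonBacktracking _ uq) , z∈

    -- Both d and the vertex m₃ after it have a third neighbour off the path; at most one of
    -- these two edges is the deleted one, and the other leads to a fourth leaf.
    no-long-path : ∀ m₃ m₄ Q → IsWalk D (lx ∷ c ∷ d ∷ m₃ ∷ m₄ ∷ Q) →
      Unique (lx ∷ c ∷ d ∷ m₃ ∷ m₄ ∷ Q) → lastOf m₄ Q ≡ lz → ⊥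
    no-long-path m₃ m₄ Q wk uq last≡z = choose (adj? D d g₂) (adj? D m₃ g₃)
      where
        from-d : Unique (d ∷ m₃ ∷ m₄ ∷ Q)
        from-d = Unique-tail (Unique-tail uq)
        walk-from-d : IsWalk A (d ∷ m₃ ∷ m₄ ∷ Q)
        walk-from-d = IsWalk-mono D D⇒A _ (proj₂ (proj₂ wk))
        m₃≢c : m₃ ≢ c
        m₃≢c e = Unique-head (Unique-tail uq) (there (here (sym e)))
        d~m₃ = proj₁ walk-from-d
        m₃~m₄ = proj₁ (proj₂ walk-from-d)
        d-deg = two-neighbours⇒deg≡3 d (m₃≢c ∘ sym) (adj-sym c~d) d~m₃
        m₃-deg = two-neighbours⇒deg≡3 m₃ (λ e → Unique-head from-d (there (here e))) (adj-sym d~m₃) m₃~m₄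
        G₂ = deg≡3⇒third-neighbour A d d-deg (adj-sym c~d) d~m₃
        g₂ = proj₁ G₂
        G₃ = deg≡3⇒third-neighbour A m₃ m₃-deg (adj-sym d~m₃) m₃~m₄
        g₃ = proj₁ G₃
        z∈ : lz ∈ m₄ ∷ Q
        z∈ = subst (_∈ m₄ ∷ Q) last≡z (lastOf-∈ m₄ Q)
        w⇝ : ∀ {v} → v ∈ lx ∷ c ∷ d ∷ m₃ ∷ m₄ ∷ Q → Reach D w v
        w⇝ v∈ = Reach-trans D x-reachable (IsWalk⇒Reach D lx _ wk v∈)
        choose : Dec (Adj D d g₂) → Dec (Adj D m₃ g₃) → ⊥
        choose (yes d~g₂) _ = no-escape (w⇝ (there (there (here refl)))) d~g₂
          (routes-from-stem (proj₁ (proj₂ (proj₂ G₂))) (proj₂ (proj₂ (proj₂ G₂))) walk-from-d from-d z∈)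
        choose (no _) (yes m₃~g₃) = no-escape (w⇝ (there (there (there (here refl))))) m₃~g₃
          (routes-after-stem (proj₁ (proj₂ (proj₂ G₃))) (proj₂ (proj₂ (proj₂ G₃))) m₃≢c d~m₃
             (proj₂ walk-from-d) (Unique-tail from-d) z∈)
        choose (no ¬d~g₂) (no ¬m₃~g₃)
          with adj∖deleteEdge⇒SameEdge A u w (proj₁ (proj₂ G₂)) ¬d~g₂
             | adj∖deleteEdge⇒SameEdge A u w (proj₁ (proj₂ G₃)) ¬m₃~g₃
        ... | inj₁ (e₁ , _) | inj₁ (e₂ , _) = Unique-head from-d (here (trans e₁ (sym e₂)))
        ... | inj₂ (e₁ , _) | inj₂ (e₂ , _) = Unique-head from-d (here (trans e₁ (sym e₂)))
        ... | inj₁ (e₁ , _) | inj₂ (_ , e₂) = proj₁ (proj₂ (proj₂ G₃)) (trans e₂ (sym e₁))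
        ... | inj₂ (e₁ , _) | inj₁ (_ , e₂) = proj₁ (proj₂ (proj₂ G₃)) (trans e₂ (sym e₁))

    leaf-next : ∀ ℓ → Adj A c (leaf T ℓ) → ∀ {v} → Adj A (leaf T ℓ) v → v ≡ c
    leaf-next ℓ c~ℓ ℓ~v = leaf-adj-unique ℓ ℓ~v (adj-sym c~ℓ)

    path-after-d : ∀ Q → IsWalk D (lx ∷ c ∷ d ∷ Q) → Unique (lx ∷ c ∷ d ∷ Q) → lastOf d Q ≡ lz → Adj A d lz
    path-after-d []                 _  _  d≡z    = ⊥-elim (d≢z d≡z)
    path-after-d (m₃ ∷ [])          wk _  m₃≡z   = subst (Adj A d) m₃≡z (D⇒A (proj₁ (proj₂ (proj₂ wk))))
    path-after-d (m₃ ∷ m₄ ∷ Q)      wk uq last≡z = ⊥-elim (no-long-path m₃ m₄ Q wk uq last≡z)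

    path-after-y : ∀ Q → IsWalk D (lx ∷ c ∷ ly ∷ Q) → Unique (lx ∷ c ∷ ly ∷ Q) → lastOf ly Q ≢ lz
    path-after-y []       _  _  y≡z = leaf-≢ y≢z y≡z
    path-after-y (m ∷ Q) wk uq _ with leaf-next y c~y (D⇒A (proj₁ (proj₂ (proj₂ wk))))
    ... | refl = Unique-head (Unique-tail uq) (there (here refl))

    path-after-c : ∀ Q → IsWalk D (lx ∷ c ∷ Q) → Unique (lx ∷ c ∷ Q) → lastOf c Q ≡ lz → Adj A d lz
    path-after-c []       _  _  c≡z = ⊥-elim (deg≡3⇒≢leaf z c-deg (sym c≡z))
    path-after-c (m ∷ Q) wk uq last≡z with c-neighbours (D⇒A (proj₁ (proj₂ wk)))
    ... | inj₁ refl        = ⊥-elim (Unique-head uq (there (here refl)))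
    ... | inj₂ (inj₁ refl) = ⊥-elim (path-after-y Q wk uq last≡z)
    ... | inj₂ (inj₂ refl) = path-after-d Q wk uq last≡z

    path-from-x : ∀ Q → IsWalk D (lx ∷ Q) → Unique (lx ∷ Q) → lastOf lx Q ≡ lz → Adj A d lz
    path-from-x []       _  _  x≡z = ⊥-elim (leaf-≢ x≢z x≡z)
    path-from-x (m ∷ Q) wk uq last≡z with leaf-next x c~x (D⇒A (proj₁ wk))
    ... | refl = path-after-c Q wk uq last≡z

    d~z : Adj A d lz
    d~z with Reach⇒path D (Reach-trans D (Reach-sym D D-sym x-reachable) (proj₂ (pendant z) (inj₂ (inj₂ refl))))
    ... | Q , wk , uq , last≡z = path-from-x Q wk uq last≡z

  cherry-shape : CherryShape T x y z
  cherry-shape = record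
    { cherry = c ; stem = d ; cherry~x = c~x ; cherry~y = c~y ; cherry~stem = c~d ; stem~z = d~z
    ; stem≢x = d≢x ; stem≢y = d≢y }

pendant-cherry-shape : ∀ {m} {T : LabGraph m} {x y z : Fin m} → IsTree T →
  x ≢ y → x ≢ z → y ≢ z → 3 < m → PendantCherry T x y z → CherryShape T x y z
pendant-cherry-shape (NT , acyclic) x≢y x≢z y≢z 3<m ((u , w , u~w , pendant) , (c , c~x , c~y)) =
  cherry-shape NT acyclic x≢y x≢z y≢z 3<m u~w pendant c~x c~y

module CherryFacts {m : ℕ} {T : LabGraph m} (NT : IsNetwork T) {x y z : Fin m}
                   (x≢y : x ≢ y) (x≢z : x ≢ z) (y≢z : y ≢ z) (S : CherryShape T x y z) where

  open CherryShape S public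
  open NetworkProperties NT

  lx = leaf T x
  ly = leaf T y
  lz = leaf T z

  cherry-deg : deg (adj T) cherry ≡ 3
  cherry-deg = two-neighbours⇒deg≡3 cherry (leaf-≢ x≢y) cherry~x cherry~y

  stem-deg : deg (adj T) stem ≡ 3
  stem-deg = two-neighbours⇒deg≡3 stem (λ e → deg≡3⇒≢leaf z cherry-deg (sym e)) (adj-sym cherry~stem) stem~z

  cherry≢stem : cherry ≢ stem
  cherry≢stem = adj⇒≢ cherry~stem

  leaf≢cherry : ∀ ℓ → leaf T ℓ ≢ cherry
  leaf≢cherry ℓ = deg≡3⇒≢leaf ℓ cherry-deg

  leaf≢stem : ∀ ℓ → leaf T ℓ ≢ stem
  leaf≢stem ℓ = deg≡3⇒≢leaf ℓ stem-deg

  cherry-neighbours : ∀ {v} → Adj (adj T) cherry v → v ≡ lx ⊎ v ≡ ly ⊎ v ≡ stem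
  cherry-neighbours =
    deg≡3⇒adj-cases (adj T) cherry cherry-deg (leaf-≢ x≢y) (stem≢x ∘ sym) (stem≢y ∘ sym) cherry~x cherry~y cherry~stem

  stem-third-neighbour-unique : ∀ {t t′} → Adj (adj T) stem t → Adj (adj T) stem t′ →
    t ≢ cherry → t ≢ lz → t′ ≢ cherry → t′ ≢ lz → t ≡ t′
  stem-third-neighbour-unique d~t d~t′ t≢c t≢z t′≢c t′≢z
    with deg≡3⇒adj-cases (adj T) stem stem-deg (leaf≢cherry z ∘ sym) (t≢c ∘ sym) (t≢z ∘ sym)
           (adj-sym cherry~stem) stem~z d~t d~t′
  ... | inj₁ e        = ⊥-elim (t′≢c e)
  ... | inj₂ (inj₁ e) = ⊥-elim (t′≢z e)
  ... | inj₂ (inj₂ e) = sym e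

-- Embeddings

Adj-irrelevant : ∀ {k} (a : Fin k → Fin k → Bool) {p q} (h h′ : Adj a p q) → h ≡ h′
Adj-irrelevant a = Decidable⇒UIP.≡-irrelevant Bool._≟_

-- Embedding without route-sym: the two orientations of an edge may be routed differently.
record OrientedEmbedding {m : ℕ} (T U : LabGraph m) : Set where
  field
    φ           : Fin (n T) → Fin (n U)
    φ-inj       : Injective _≡_ _≡_ φ
    φ-leaf      : ∀ ℓ → φ (leaf T ℓ) ≡ leaf U ℓ
    route       : (a b : Fin (n T)) → Adj (adj T) a b → List (Fin (n U))
    route-path  : ∀ a b (h : Adj (adj T) a b) →
                  IsWalk (adj U) (φ a ∷ route a b h ++ [ φ b ]) × Unique (φ a ∷ route a b h ++ [ φ b ])
    route-avoid : ∀ a b (h : Adj (adj T) a b) w → w ∈ route a b h → ∀ t → φ t ≢ w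
    route-disj  : ∀ a b c d (h : Adj (adj T) a b) (h′ : Adj (adj T) c d) → ¬ SameEdge a b c d →
                  ∀ w → w ∈ route a b h → w ∈ route c d h′ → ⊥

  path : ∀ a b → Adj (adj T) a b → List (Fin (n U))
  path a b h = φ a ∷ route a b h ++ [ φ b ]

  ∈-path⁻ : ∀ a b h {z} → z ∈ path a b h → z ≡ φ a ⊎ z ∈ route a b h ⊎ z ≡ φ b
  ∈-path⁻ a b h = ∈-enclosed⁻ (route a b h)

  shared⇒endpoint : ∀ a b c d (h : Adj (adj T) a b) (h′ : Adj (adj T) c d) → ¬ SameEdge a b c d →
    ∀ {z} → z ∈ path a b h → z ∈ path c d h′ → (z ≡ φ a ⊎ z ≡ φ b) × (z ≡ φ c ⊎ z ≡ φ d)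
  shared⇒endpoint a b c d h h′ ¬same {z} p q with ∈-path⁻ a b h p | ∈-path⁻ c d h′ q
  ... | inj₂ (inj₁ r) | inj₁ e         = ⊥-elim (route-avoid a b h z r c (sym e))
  ... | inj₂ (inj₁ r) | inj₂ (inj₂ e)  = ⊥-elim (route-avoid a b h z r d (sym e))
  ... | inj₂ (inj₁ r) | inj₂ (inj₁ r′) = ⊥-elim (route-disj a b c d h h′ ¬same z r r′)
  ... | inj₁ e        | inj₂ (inj₁ r′) = ⊥-elim (route-avoid c d h′ z r′ a (sym e))
  ... | inj₂ (inj₂ e) | inj₂ (inj₁ r′) = ⊥-elim (route-avoid c d h′ z r′ b (sym e))
  ... | inj₁ e        | inj₁ e′        = inj₁ e , inj₁ e′
  ... | inj₁ e        | inj₂ (inj₂ e′) = inj₁ e , inj₂ e′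
  ... | inj₂ (inj₂ e) | inj₁ e′        = inj₂ e , inj₁ e′
  ... | inj₂ (inj₂ e) | inj₂ (inj₂ e′) = inj₂ e , inj₂ e′

  -- Two distinct shared vertices would have to be the images of both ends of both edges.
  shared-unique : ∀ a b c d (h : Adj (adj T) a b) (h′ : Adj (adj T) c d) → ¬ SameEdge a b c d →
    ∀ {z z′} → z ≢ z′ → z ∈ path a b h → z ∈ path c d h′ → z′ ∈ path a b h → z′ ∈ path c d h′ → ⊥
  shared-unique a b c d h h′ ¬same z≢z′ z₁ z₂ z′₁ z′₂
    with shared⇒endpoint a b c d h h′ ¬same z₁ z₂ | shared⇒endpoint a b c d h h′ ¬same z′₁ z′₂
  ... | inj₁ za , _       | inj₁ z′a , _        = z≢z′ (trans za (sym z′a))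
  ... | inj₂ zb , _       | inj₂ z′b , _        = z≢z′ (trans zb (sym z′b))
  ... | _ , inj₁ zc       | _ , inj₁ z′c        = z≢z′ (trans zc (sym z′c))
  ... | _ , inj₂ zd       | _ , inj₂ z′d        = z≢z′ (trans zd (sym z′d))
  ... | inj₁ za , inj₁ zc | inj₂ z′b , inj₂ z′d =
    ¬same (inj₁ (φ-inj (trans (sym za) zc) , φ-inj (trans (sym z′b) z′d)))
  ... | inj₁ za , inj₂ zd | inj₂ z′b , inj₁ z′c =
    ¬same (inj₂ (φ-inj (trans (sym za) zd) , φ-inj (trans (sym z′b) z′c)))
  ... | inj₂ zb , inj₁ zc | inj₁ z′a , inj₂ z′d =
    ¬same (inj₂ (φ-inj (trans (sym z′a) z′d) , φ-inj (trans (sym zb) zc)))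
  ... | inj₂ zb , inj₂ zd | inj₁ z′a , inj₁ z′c =
    ¬same (inj₁ (φ-inj (trans (sym z′a) z′c) , φ-inj (trans (sym zb) zd)))

  exit : ∀ t a → Adj (adj T) t a → Fin (n U)
  exit t a h = headOr (route t a h) (φ a)

  exit-adj-in : ∀ {B} t a h → IsWalk B (path t a h) → Adj B (φ t) (exit t a h)
  exit-adj-in {B} t a h = IsWalk-headOr B (φ t) (route t a h) (φ a)

  exit-adj : ∀ t a h → Adj (adj U) (φ t) (exit t a h)
  exit-adj t a h = exit-adj-in t a h (proj₁ (route-path t a h))

  Beyond : ∀ a b → Adj (adj T) a b → Fin (n U) → Set
  Beyond a b h w = w ≡ φ b ⊎ w ∈ route a b h

  exit-beyond : ∀ t a h → Beyond t a h (exit t a h)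
  exit-beyond t a h = headOr-cases (route t a h) (φ a)

  exit-≢-image : ∀ t a h {s} → s ≢ a → exit t a h ≢ φ s
  exit-≢-image t a h s≢a e with exit-beyond t a h
  ... | inj₁ e′ = s≢a (φ-inj (trans (sym e) e′))
  ... | inj₂ p  = route-avoid t a h _ p _ (sym e)

  exit-injective : (∀ {a} → ¬ Adj (adj T) a a) → ∀ t a b (h : Adj (adj T) t a) (h′ : Adj (adj T) t b) → a ≢ b →
    exit t a h ≢ exit t b h′
  exit-injective T-loopless t a b h h′ a≢b e with exit-beyond t a h | exit-beyond t b h′
  ... | inj₁ x | inj₁ y = a≢b (φ-inj (trans (sym x) (trans e y)))
  ... | inj₁ x | inj₂ y = route-avoid t b h′ _ y a (trans (sym x) e)
  ... | inj₂ x | inj₁ y = route-avoid t a h _ x b (trans (sym y) (sym e))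
  ... | inj₂ x | inj₂ y = route-disj t a t b h h′ ¬same _ x (subst (_∈ route t b h′) (sym e) y)
    where
      ¬same : ¬ SameEdge t a t b
      ¬same (inj₁ (_ , a≡b))     = a≢b a≡b
      ¬same (inj₂ (refl , refl)) = T-loopless h

  route-vs-beyond : ∀ a b a′ b′ h h′ → ¬ SameEdge a b a′ b′ → ∀ {w} → w ∈ route a b h → Beyond a′ b′ h′ w → ⊥
  route-vs-beyond a b a′ b′ h h′ ¬same p (inj₁ e) = route-avoid a b h _ p b′ (sym e)
  route-vs-beyond a b a′ b′ h h′ ¬same p (inj₂ q) = route-disj a b a′ b′ h h′ ¬same _ p q

  beyond-vs-beyond : ∀ a b a′ b′ h h′ → ¬ SameEdge a b a′ b′ → b ≢ b′ →
    ∀ {w} → Beyond a b h w → Beyond a′ b′ h′ w → ⊥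
  beyond-vs-beyond a b a′ b′ h h′ ¬same b≢b′ (inj₁ e) (inj₁ e′) = b≢b′ (φ-inj (trans (sym e) e′))
  beyond-vs-beyond a b a′ b′ h h′ ¬same b≢b′ (inj₁ e) (inj₂ q)  = route-avoid a′ b′ h′ _ q b (sym e)
  beyond-vs-beyond a b a′ b′ h h′ ¬same b≢b′ (inj₂ p) q         = route-vs-beyond a b a′ b′ h h′ ¬same p q

forget-orientation : ∀ {m} {T U : LabGraph m} → Embedding T U → OrientedEmbedding T U
forget-orientation E = record
  { φ = φ ; φ-inj = φ-inj ; φ-leaf = φ-leaf ; route = route ; route-path = route-path
  ; route-avoid = route-avoid ; route-disj = route-disj }
  where open Embedding E

module _ {m : ℕ} {T U : LabGraph m}
         (T-sym : ∀ {a b} → Adj (adj T) a b → Adj (adj T) b a) (T-loopless : ∀ {a} → ¬ Adj (adj T) a a)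
         (U-sym : ∀ {p q} → Adj (adj U) p q → Adj (adj U) q p) (E : OrientedEmbedding T U) where

  open OrientedEmbedding E

  private
    oriented-route : ∀ a b → Adj (adj T) a b → Dec (a Fin.< b) → List (Fin (n U))
    oriented-route a b h (yes _) = route a b h
    oriented-route a b h (no _)  = reverse (route b a (T-sym h))

    oriented-route-sym : ∀ a b (h : Adj (adj T) a b) (h′ : Adj (adj T) b a) δ δ′ →
      oriented-route b a h′ δ′ ≡ reverse (oriented-route a b h δ)
    oriented-route-sym a b h h′ (yes a<b) (yes b<a) = ⊥-elim (<-asym a<b b<a)
    oriented-route-sym a b h h′ (yes _)   (no _)    = cong (reverse ∘ route a b) (Adj-irrelevant (adj T) _ _)
    oriented-route-sym a b h h′ (no _)    (yes _)   =
      trans (cong (route b a) (Adj-irrelevant (adj T) _ _)) (sym (reverse-involutive _))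
    oriented-route-sym a b h h′ (no a≮b)  (no b≮a) with <-cmp a b
    ... | tri< a<b _ _  = ⊥-elim (a≮b a<b)
    ... | tri≈ _ refl _ = ⊥-elim (T-loopless h)
    ... | tri> _ _ b<a  = ⊥-elim (b≮a b<a)

    oriented-route-path : ∀ a b h δ →
      IsWalk (adj U) (φ a ∷ oriented-route a b h δ ++ [ φ b ]) × Unique (φ a ∷ oriented-route a b h δ ++ [ φ b ])
    oriented-route-path a b h (yes _) = route-path a b h
    oriented-route-path a b h (no _) rewrite sym (reverse-path (φ a) (route b a (T-sym h)) (φ b)) =
      IsWalk-reverse (adj U) U-sym _ (proj₁ (route-path b a (T-sym h))) ,
      Unique-reverse _ (proj₂ (route-path b a (T-sym h)))

    ∈-oriented-route : ∀ a b h δ {w} → w ∈ oriented-route a b h δ →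
      w ∈ route a b h ⊎ w ∈ route b a (T-sym h)
    ∈-oriented-route a b h (yes _) p = inj₁ p
    ∈-oriented-route a b h (no _)  p = inj₂ (Anyₚ.reverse⁻ p)

    disjoint-oriented : ∀ a b c d (h : Adj (adj T) a b) (h′ : Adj (adj T) c d) → ¬ SameEdge a b c d →
      ∀ w → w ∈ route a b h ⊎ w ∈ route b a (T-sym h) → w ∈ route c d h′ ⊎ w ∈ route d c (T-sym h′) → ⊥
    disjoint-oriented a b c d h h′ ¬same w (inj₁ p) (inj₁ q) = route-disj a b c d h h′ ¬same w p q
    disjoint-oriented a b c d h h′ ¬same w (inj₁ p) (inj₂ q) =
      route-disj a b d c h (T-sym h′) (¬same ∘ SameEdge-flipʳ) w p q
    disjoint-oriented a b c d h h′ ¬same w (inj₂ p) (inj₁ q) =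
      route-disj b a c d (T-sym h) h′ (¬same ∘ SameEdge-flipˡ) w p q
    disjoint-oriented a b c d h h′ ¬same w (inj₂ p) (inj₂ q) =
      route-disj b a d c (T-sym h) (T-sym h′)
        (¬same ∘ SameEdge-flipˡ ∘ SameEdge-flipʳ) w p q

  symmetrize : Embedding T U
  symmetrize = record
    { φ           = φ
    ; φ-inj       = φ-inj
    ; φ-leaf      = φ-leaf
    ; route       = λ a b h → oriented-route a b h (a Fin.<? b)
    ; route-sym   = λ a b h h′ → oriented-route-sym a b h h′ (a Fin.<? b) (b Fin.<? a)
    ; route-path  = λ a b h → oriented-route-path a b h (a Fin.<? b)
    ; route-avoid = λ a b h w p t → [ (λ q → route-avoid a b h w q t) , (λ q → route-avoid b a (T-sym h) w q t) ]′
                                      (∈-oriented-route a b h (a Fin.<? b) p)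
    ; route-disj  = λ a b c d h h′ ¬same w p q → disjoint-oriented a b c d h h′ ¬same w
                      (∈-oriented-route a b h (a Fin.<? b) p) (∈-oriented-route c d h′ (c Fin.<? d) q)
    }

module _ {m : ℕ} {T U : LabGraph m} (E : OrientedEmbedding T U) where

  open OrientedEmbedding E

  AvoidsEdge : Fin (n U) → Fin (n U) → Set
  AvoidsEdge u v = ∀ a b h → IsWalk (deleteEdge (adj U) u v) (path a b h)

  -- A branch vertex of T needs all three edges at its image, and a leaf of T maps to a leaf of U.
  avoided-edge-end-not-image : IsNetwork T → IsNetwork U → ∀ {u v} → AvoidsEdge u v →
    ∀ {X Y} → SameEdge X Y u v → Adj (adj U) X Y → deg (adj U) X ≡ 3 → ∀ t → φ t ≢ X
  avoided-edge-end-not-image NT NU avoids edge X~Y X-deg t φt≡X with IsNetwork.degrees NT t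
  ... | inj₁ t-leaf with IsNetwork.deg1-leaf NT t t-leaf
  ...   | ℓ , refl = NetworkProperties.deg≡3⇒≢leaf NU ℓ X-deg (trans (sym (φ-leaf ℓ)) φt≡X)
  avoided-edge-end-not-image NT NU {u} {v} avoids {X} edge X~Y X-deg t φt≡X | inj₂ t-deg
    with deleteEdge-end-neighbours (adj U) X-deg X~Y edge | deg≡3⇒three-neighbours (adj T) t t-deg
  ... | p , q , among | a₁ , a₂ , a₃ , h₁ , h₂ , h₃ , a₁≢a₂ , a₁≢a₃ , a₂≢a₃ =
    pigeonhole₃ (distinct h₁ h₂ a₁≢a₂) (distinct h₁ h₃ a₁≢a₃) (distinct h₂ h₃ a₂≢a₃)
                (among (exit-D h₁)) (among (exit-D h₂)) (among (exit-D h₃))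
    where
      distinct : ∀ {a b} h h′ → a ≢ b → exit t a h ≢ exit t b h′
      distinct = exit-injective (NetworkProperties.adj-irrefl NT) t _ _
      exit-D : ∀ {a} h → Adj (deleteEdge (adj U) u v) X (exit t a h)
      exit-D {a} h = subst (λ x → Adj (deleteEdge (adj U) u v) x (exit t a h)) φt≡X
                       (exit-adj-in t a h (avoids t a h))

-- Eliminating an edge

Eliminates-sym : ∀ {m} {U U′ : LabGraph m} {u v} → Eliminates U u v U′ →
  (∀ {p q} → Adj (adj U) p q → Adj (adj U) q p) → ∀ {a b} → Adj (adj U′) a b → Adj (adj U′) b a
Eliminates-sym El U-sym {a} {b} h with Eliminates.ι-adj El a b h
... | inj₁ e                                     = Eliminates.ι-adj⁻ El b a (inj₁ (U-sym e))
... | inj₂ (inj₁ (up , uq , p≢q , p≢v , q≢v))   = Eliminates.ι-adj⁻ El b a (inj₂ (inj₁ (uq , up , p≢q ∘ sym , q≢v , p≢v)))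
... | inj₂ (inj₂ (vp , vq , p≢q , p≢u , q≢u))   = Eliminates.ι-adj⁻ El b a (inj₂ (inj₂ (vq , vp , p≢q ∘ sym , q≢u , p≢u)))

module Contraction {m : ℕ} {U U′ : LabGraph m} {u v : Fin (n U)} (El : Eliminates U u v U′)
                   (U-sym : ∀ {p q} → Adj (adj U) p q → Adj (adj U) q p) where

  open Eliminates El
  private
    D = deleteEdge (adj U) u v

    D⇒U : ∀ {p q} → Adj D p q → Adj (adj U) p q
    D⇒U = deleteEdge⇒adj (adj U) u v

  -- u and v, which have no preimage, are dropped.
  preimages : List (Fin (n U)) → List (Fin (n U′))
  preimages []      = []
  preimages (w ∷ L) with any? (λ a → ι a ≟ w)
  ... | yes (a , _) = a ∷ preimages L
  ... | no _        = preimages L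

  preimages-ι : ∀ a L → preimages (ι a ∷ L) ≡ a ∷ preimages L
  preimages-ι a L with any? (λ a′ → ι a′ ≟ ι a)
  ... | yes (a′ , e) = cong (_∷ preimages L) (ι-inj e)
  ... | no none      = ⊥-elim (none (a , refl))

  preimages-end : ∀ {X Y} L → SameEdge X Y u v → preimages (X ∷ L) ≡ preimages L
  preimages-end {X} L edge with any? (λ a → ι a ≟ X)
  ... | no _ = refl
  ... | yes (a , refl) with edge
  ...   | inj₁ (e , _) = ⊥-elim (proj₁ (ι-avoid a) e)
  ...   | inj₂ (e , _) = ⊥-elim (proj₂ (ι-avoid a) e)

  ∈-preimages⁻ : ∀ L {a} → a ∈ preimages L → ι a ∈ L
  ∈-preimages⁻ (w ∷ L) p with any? (λ a → ι a ≟ w)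
  ∈-preimages⁻ (w ∷ L) (here refl) | yes (_ , e) = here e
  ∈-preimages⁻ (w ∷ L) (there p)   | yes _       = there (∈-preimages⁻ L p)
  ∈-preimages⁻ (w ∷ L) p           | no _        = there (∈-preimages⁻ L p)

  preimages-++ : ∀ L M → preimages (L ++ M) ≡ preimages L ++ preimages M
  preimages-++ []      M = refl
  preimages-++ (w ∷ L) M with any? (λ a → ι a ≟ w)
  ... | yes (a , _) = cong (a ∷_) (preimages-++ L M)
  ... | no _        = preimages-++ L M

  Unique-preimages : ∀ L → Unique L → Unique (preimages L)
  Unique-preimages []      _  = []
  Unique-preimages (w ∷ L) uq with any? (λ a → ι a ≟ w)
  ... | yes (a , refl) = Unique-∷ (Unique-head uq ∘ ∈-preimages⁻ L) (Unique-preimages L (Unique-tail uq))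
  ... | no _           = Unique-preimages L (Unique-tail uq)

  end-or-image : ∀ w → (∃ λ Y → SameEdge w Y u v) ⊎ (∃ λ a → ι a ≡ w)
  end-or-image w with w ≟ u | w ≟ v
  ... | yes w≡u | _       = inj₁ (v , inj₁ (w≡u , refl))
  ... | no _    | yes w≡v = inj₁ (u , inj₂ (w≡v , refl))
  ... | no w≢u  | no w≢v  = inj₂ (ι-range w w≢u w≢v)

  through-end : ∀ {X Y s t} → SameEdge X Y u v → Adj (adj U) X (ι s) → Adj (adj U) X (ι t) → s ≢ t →
    Adj (adj U′) s t
  through-end {s = s} {t} (inj₁ (refl , refl)) X~s X~t s≢t =
    ι-adj⁻ s t (inj₂ (inj₁ (X~s , X~t , s≢t ∘ ι-inj , proj₂ (ι-avoid s) , proj₂ (ι-avoid t))))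
  through-end {s = s} {t} (inj₂ (refl , refl)) X~s X~t s≢t =
    ι-adj⁻ s t (inj₂ (inj₂ (X~s , X~t , s≢t ∘ ι-inj , proj₁ (ι-avoid s) , proj₁ (ι-avoid t))))

  private
    ends-adjacent : ∀ {X Y w Y′} → SameEdge X Y u v → SameEdge w Y′ u v → X ≢ w → SameEdge X w u v
    ends-adjacent (inj₁ (refl , _)) (inj₁ (refl , _)) X≢w = ⊥-elim (X≢w refl)
    ends-adjacent (inj₁ (refl , _)) (inj₂ (refl , _)) _   = inj₁ (refl , refl)
    ends-adjacent (inj₂ (refl , _)) (inj₁ (refl , _)) _   = inj₂ (refl , refl)
    ends-adjacent (inj₂ (refl , _)) (inj₂ (refl , _)) X≢w = ⊥-elim (X≢w refl)

  -- A path of the deleted graph enters and leaves an end X of {u,v} through the two other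
  -- neighbours of X, which are adjacent in U′.
  contract-walk : ∀ s M t → IsWalk D (ι s ∷ M ++ [ ι t ]) → Unique (ι s ∷ M ++ [ ι t ]) →
    IsWalk (adj U′) (s ∷ preimages M ++ [ t ])
  contract-walk-through : ∀ {X Y} → SameEdge X Y u v → ∀ s M t → Adj D (ι s) X →
    IsWalk D (X ∷ M ++ [ ι t ]) → Unique (ι s ∷ X ∷ M ++ [ ι t ]) →
    IsWalk (adj U′) (s ∷ preimages (X ∷ M) ++ [ t ])

  contract-walk s []      t (s~t , _) _ = ι-adj⁻ s t (inj₁ (D⇒U s~t)) , tt
  contract-walk s (w ∷ M) t (s~w , wk) uq with end-or-image w
  ... | inj₁ (_ , edge)  = contract-walk-through edge s M t s~w wk uq
  ... | inj₂ (a , refl) rewrite preimages-ι a M =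
    ι-adj⁻ s a (inj₁ (D⇒U s~w)) , contract-walk a M t wk (Unique-tail uq)

  contract-walk-through {X} edge s [] t s~X (X~t , _) uq rewrite preimages-end [] edge =
    through-end edge (U-sym (D⇒U s~X)) (D⇒U X~t) (λ s≡t → Unique-head uq (there (here (cong ι s≡t)))) , tt
  contract-walk-through {X} edge s (w ∷ M) t s~X (X~w , wk) uq with end-or-image w
  ... | inj₁ (_ , edge′) =
    ⊥-elim (deleteEdge-removes (adj U) u v (ends-adjacent edge edge′ λ X≡w → Unique-head (Unique-tail uq) (here X≡w)) X~w)
  ... | inj₂ (a , refl) rewrite preimages-end (ι a ∷ M) edge | preimages-ι a M =
    through-end edge (U-sym (D⇒U s~X)) (D⇒U X~w) (λ s≡a → Unique-head uq (there (here (cong ι s≡a)))) ,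
    contract-walk a M t wk (Unique-tail (Unique-tail uq))

  module _ {T : LabGraph m} (E : OrientedEmbedding T U) (avoids : AvoidsEdge E u v)
           (not-image : ∀ t → OrientedEmbedding.φ E t ≢ u × OrientedEmbedding.φ E t ≢ v) where

    open OrientedEmbedding E

    private
      φ′ : Fin (n T) → Fin (n U′)
      φ′ t = proj₁ (ι-range (φ t) (proj₁ (not-image t)) (proj₂ (not-image t)))

      ι-φ′ : ∀ t → ι (φ′ t) ≡ φ t
      ι-φ′ t = proj₂ (ι-range (φ t) (proj₁ (not-image t)) (proj₂ (not-image t)))

      path-ι : ∀ a b h → path a b h ≡ ι (φ′ a) ∷ route a b h ++ [ ι (φ′ b) ]
      path-ι a b h rewrite ι-φ′ a | ι-φ′ b = refl

      contracted-path : ∀ a b h → preimages (ι (φ′ a) ∷ route a b h ++ [ ι (φ′ b) ])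
                                 ≡ φ′ a ∷ preimages (route a b h) ++ [ φ′ b ]
      contracted-path a b h rewrite preimages-ι (φ′ a) (route a b h ++ [ ι (φ′ b) ])
                                  | preimages-++ (route a b h) [ ι (φ′ b) ]
                                  | preimages-ι (φ′ b) [] = refl

    contract : OrientedEmbedding T U′
    contract = record
      { φ           = φ′
      ; φ-inj       = λ e → φ-inj (trans (sym (ι-φ′ _)) (trans (cong ι e) (ι-φ′ _)))
      ; φ-leaf      = λ ℓ → ι-inj (trans (ι-φ′ (leaf T ℓ)) (trans (φ-leaf ℓ) (sym (ι-leaf ℓ))))
      ; route       = λ a b h → preimages (route a b h)
      ; route-path  = λ a b h →
          contract-walk (φ′ a) (route a b h) (φ′ b) (subst (IsWalk D) (path-ι a b h) (avoids a b h))
            (subst Unique (path-ι a b h) (proj₂ (route-path a b h))) ,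
          subst Unique (contracted-path a b h)
            (Unique-preimages _ (subst Unique (path-ι a b h) (proj₂ (route-path a b h))))
      ; route-avoid = λ a b h w p t e →
          route-avoid a b h (ι w) (∈-preimages⁻ (route a b h) p) t (trans (sym (ι-φ′ t)) (cong ι e))
      ; route-disj  = λ a b c d h h′ ¬same w p q →
          route-disj a b c d h h′ ¬same (ι w) (∈-preimages⁻ (route a b h) p) (∈-preimages⁻ (route c d h′) q)
      }

module Expansion {m : ℕ} {U U′ : LabGraph m} {u v : Fin (n U)} (El : Eliminates U u v U′)
                 (NU : IsNetwork U)
                 (u-deg : deg (adj U) u ≡ 3) (v-deg : deg (adj U) v ≡ 3) (u~v : Adj (adj U) u v) where

  open Eliminates El
  open NetworkProperties NU using () renaming (adj-sym to U-sym; adj-irrefl to U-loopless)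
  private
    A = adj U

    ι≢end : ∀ a {X} → X ≡ u ⊎ X ≡ v → ι a ≢ X
    ι≢end a (inj₁ refl) = proj₁ (ι-avoid a)
    ι≢end a (inj₂ refl) = proj₂ (ι-avoid a)

  U′-adj⇒≢ : ∀ {s t} → Adj (adj U′) s t → s ≢ t
  U′-adj⇒≢ {s} h refl with ι-adj s s h
  ... | inj₁ loop                      = U-loopless loop
  ... | inj₂ (inj₁ (_ , _ , s≢s , _)) = s≢s refl
  ... | inj₂ (inj₂ (_ , _ , s≢s , _)) = s≢s refl

  Flanked : Fin (n U) → Fin (n U′) → Fin (n U′) → Set
  Flanked X a b = Adj A X (ι a) × Adj A X (ι b)

  -- The vertex, if any, that was suppressed on the U′-edge from p to q.
  subdivider : Fin (n U) → Fin (n U) → List (Fin (n U))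
  subdivider p q = if A p q then [] else if A u p ∧ A u q then [ u ] else [ v ]

  private
    subdivider-cases : ∀ p q → (A p q ≡ true × subdivider p q ≡ [])
      ⊎ (A p q ≡ false × A u p ≡ true × A u q ≡ true × subdivider p q ≡ [ u ])
      ⊎ (A p q ≡ false × (A u p ≡ false ⊎ A u q ≡ false) × subdivider p q ≡ [ v ])
    subdivider-cases p q with A p q
    ... | true = inj₁ (refl , refl)
    ... | false with A u p | A u q
    ...   | true  | true  = inj₂ (inj₁ (refl , refl , refl , refl))
    ...   | true  | false = inj₂ (inj₂ (refl , inj₂ refl , refl))
    ...   | false | _     = inj₂ (inj₂ (refl , inj₁ refl , refl))

    v-flanks : ∀ s t → Adj (adj U′) s t → A (ι s) (ι t) ≡ false → (A u (ι s) ≡ false ⊎ A u (ι t) ≡ false) →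
      Flanked v s t
    v-flanks s t h ¬st ¬us⊎¬ut with ι-adj s t h
    ... | inj₁ st                   = ⊥-elim (true≢false st ¬st)
    ... | inj₂ (inj₁ (us , ut , _)) = ⊥-elim ([ true≢false us , true≢false ut ]′ ¬us⊎¬ut)
    ... | inj₂ (inj₂ (vs , vt , _)) = vs , vt

  subdivider-walk : ∀ s t → Adj (adj U′) s t → IsWalk A (ι s ∷ subdivider (ι s) (ι t) ++ [ ι t ])
  subdivider-walk s t h with subdivider-cases (ι s) (ι t)
  ... | inj₁ (st , eq) rewrite eq = st , tt
  ... | inj₂ (inj₁ (_ , us , ut , eq)) rewrite eq = U-sym us , ut , tt
  ... | inj₂ (inj₂ (¬st , ¬us⊎¬ut , eq)) rewrite eq =
    U-sym (proj₁ (v-flanks s t h ¬st ¬us⊎¬ut)) , proj₂ (v-flanks s t h ¬st ¬us⊎¬ut) , tt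

  subdivider-end : ∀ p q {X} → X ∈ subdivider p q → X ≡ u ⊎ X ≡ v
  subdivider-end p q X∈ with subdivider-cases p q
  ... | inj₁ (_ , eq) rewrite eq = case X∈ of λ ()
  ... | inj₂ (inj₁ (_ , _ , _ , eq)) rewrite eq with X∈
  ...   | here refl = inj₁ refl
  subdivider-end p q X∈ | inj₂ (inj₂ (_ , _ , eq)) rewrite eq with X∈
  ...   | here refl = inj₂ refl

  subdivider-flanked : ∀ s t → Adj (adj U′) s t → ∀ {X} → X ∈ subdivider (ι s) (ι t) → Flanked X s t
  subdivider-flanked s t h X∈ with subdivider-cases (ι s) (ι t)
  ... | inj₁ (_ , eq) rewrite eq = case X∈ of λ ()
  ... | inj₂ (inj₁ (_ , us , ut , eq)) rewrite eq with X∈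
  ...   | here refl = us , ut
  subdivider-flanked s t h X∈ | inj₂ (inj₂ (¬st , ¬us⊎¬ut , eq)) rewrite eq with X∈
  ...   | here refl = v-flanks s t h ¬st ¬us⊎¬ut

  Unique-subdivider : ∀ p q → Unique (subdivider p q)
  Unique-subdivider p q with subdivider-cases p q
  ... | inj₁ (_ , eq) rewrite eq                 = []
  ... | inj₂ (inj₁ (_ , _ , _ , eq)) rewrite eq = [] ∷ []
  ... | inj₂ (inj₂ (_ , _ , eq)) rewrite eq     = [] ∷ []

  -- Besides the other end of the eliminated edge, an end X has only two neighbours.
  flanked-unique : ∀ {X} → X ≡ u ⊎ X ≡ v → ∀ {a b} → a ≢ b → Flanked X a b → ∀ {c} → Adj A X (ι c) →
    c ≡ a ⊎ c ≡ b
  flanked-unique {X} end {a} {b} a≢b (Xa , Xb) {c} Xc = from-other-end end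
    where
      classify : ∀ Y → deg A X ≡ 3 → Adj A X Y → Y ≡ u ⊎ Y ≡ v → c ≡ a ⊎ c ≡ b
      classify Y X-deg XY Y-end
        with deg≡3⇒adj-cases A X X-deg (ι≢end a Y-end ∘ sym) (ι≢end b Y-end ∘ sym) (a≢b ∘ ι-inj) XY Xa Xb Xc
      ... | inj₁ e        = ⊥-elim (ι≢end c Y-end e)
      ... | inj₂ (inj₁ e) = inj₁ (ι-inj e)
      ... | inj₂ (inj₂ e) = inj₂ (ι-inj e)
      from-other-end : X ≡ u ⊎ X ≡ v → c ≡ a ⊎ c ≡ b
      from-other-end (inj₁ refl) = classify v u-deg u~v (inj₂ refl)
      from-other-end (inj₂ refl) = classify u v-deg (U-sym u~v) (inj₁ refl)

  expand-interior : Fin (n U′) → List (Fin (n U′)) → Fin (n U′) → List (Fin (n U))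
  expand-interior s []      t = subdivider (ι s) (ι t)
  expand-interior s (w ∷ r) t = subdivider (ι s) (ι w) ++ ι w ∷ expand-interior w r t

  expand-walk : ∀ s r t → IsWalk (adj U′) (s ∷ r ++ [ t ]) → IsWalk A (ι s ∷ expand-interior s r t ++ [ ι t ])
  expand-walk s []      t (h , _)  = subdivider-walk s t h
  expand-walk s (w ∷ r) t (h , wk) =
    subst (IsWalk A) (cong (ι s ∷_) (sym (++-assoc (subdivider (ι s) (ι w)) (ι w ∷ expand-interior w r t) [ ι t ])))
      (IsWalk-++ A (ι s ∷ subdivider (ι s) (ι w)) (expand-interior w r t ++ [ ι t ])
        (subdivider-walk s w h) (expand-walk w r t wk))

  ∈-expand⁻ : ∀ s r t {y} → y ∈ expand-interior s r t → (∃ λ z → z ∈ r × y ≡ ι z) ⊎ y ≡ u ⊎ y ≡ v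
  ∈-expand⁻ s []      t p = inj₂ (subdivider-end _ _ p)
  ∈-expand⁻ s (w ∷ r) t p with ∈-++⁻ (subdivider (ι s) (ι w)) p
  ... | inj₁ q         = inj₂ (subdivider-end _ _ q)
  ... | inj₂ (here e)  = inj₁ (w , here refl , e)
  ... | inj₂ (there q) with ∈-expand⁻ w r t q
  ...   | inj₁ (z , z∈r , e) = inj₁ (z , there z∈r , e)
  ...   | inj₂ end           = inj₂ end

  end∈expand⇒flanked : ∀ s r t {X} → X ≡ u ⊎ X ≡ v → IsWalk (adj U′) (s ∷ r ++ [ t ]) →
    X ∈ expand-interior s r t →
    ∃ λ a → ∃ λ b → a ∈ s ∷ r ++ [ t ] × b ∈ s ∷ r ++ [ t ] × a ≢ b × Flanked X a b
  end∈expand⇒flanked s [] t end (h , _) p =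
    s , t , here refl , there (here refl) , U′-adj⇒≢ h , subdivider-flanked s t h p
  end∈expand⇒flanked s (w ∷ r) t end (h , wk) p with ∈-++⁻ (subdivider (ι s) (ι w)) p
  ... | inj₁ q        = s , w , here refl , there (here refl) , U′-adj⇒≢ h , subdivider-flanked s w h q
  ... | inj₂ (here e) = ⊥-elim (ι≢end w end (sym e))
  ... | inj₂ (there q) with end∈expand⇒flanked w r t end wk q
  ...   | a , b , a∈ , b∈ , a≢b , flanked = a , b , there a∈ , there b∈ , a≢b , flanked

  ∈-expand-path⁻ : ∀ s r t {y} → y ∈ ι s ∷ expand-interior s r t ++ [ ι t ] →
    (∃ λ z → z ∈ s ∷ r ++ [ t ] × y ≡ ι z) ⊎ y ≡ u ⊎ y ≡ v
  ∈-expand-path⁻ s r t (here e)  = inj₁ (s , here refl , e)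
  ∈-expand-path⁻ s r t (there p) with ∈-++⁻ (expand-interior s r t) p
  ... | inj₂ (here e) = inj₁ (t , there (∈-++⁺ʳ r (here refl)) , e)
  ... | inj₁ q with ∈-expand⁻ s r t q
  ...   | inj₁ (z , z∈r , e) = inj₁ (z , there (∈-++⁺ˡ z∈r) , e)
  ...   | inj₂ end           = inj₂ end

  Unique-expand : ∀ s r t → Unique (s ∷ r ++ [ t ]) → IsWalk (adj U′) (s ∷ r ++ [ t ]) →
    Unique (ι s ∷ expand-interior s r t ++ [ ι t ])
  Unique-expand s [] t uq _ =
    Unique-∷ s-fresh (Unique-∷ʳ _ (Unique-subdivider _ _) (λ p → ι≢end t (subdivider-end _ _ p) refl))
    where
      s-fresh : ι s ∉ subdivider (ι s) (ι t) ++ [ ι t ]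
      s-fresh p with ∈-++⁻ (subdivider (ι s) (ι t)) p
      ... | inj₁ q        = ι≢end s (subdivider-end _ _ q) refl
      ... | inj₂ (here e) = Unique-head uq (here (ι-inj e))
  Unique-expand s (w ∷ r) t uq (h , wk) =
    subst Unique (cong (ι s ∷_) (sym (++-assoc (subdivider (ι s) (ι w)) (ι w ∷ expand-interior w r t) [ ι t ])))
      (Unique-∷ s-fresh (Unique.++⁺ (Unique-subdivider _ _) (Unique-expand w r t (Unique-tail uq) wk) disjoint))
    where
      rest = ι w ∷ expand-interior w r t ++ [ ι t ]
      s∉ : s ∉ w ∷ r ++ [ t ]
      s∉ = Unique-head uq
      s-fresh : ι s ∉ subdivider (ι s) (ι w) ++ rest
      s-fresh p with ∈-++⁻ (subdivider (ι s) (ι w)) p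
      ... | inj₁ q = ι≢end s (subdivider-end _ _ q) refl
      ... | inj₂ q with ∈-expand-path⁻ w r t q
      ...   | inj₁ (z , z∈ , e) = s∉ (subst (_∈ w ∷ r ++ [ t ]) (sym (ι-inj e)) z∈)
      ...   | inj₂ end          = ι≢end s end refl
      disjoint : Disjoint (subdivider (ι s) (ι w)) rest
      disjoint (X∈sub , here e)  = ι≢end w (subdivider-end _ _ X∈sub) (sym e)
      disjoint (X∈sub , there q) with ∈-++⁻ (expand-interior w r t) q
      ... | inj₂ (here e) = ι≢end t (subdivider-end _ _ X∈sub) (sym e)
      ... | inj₁ q′ with end∈expand⇒flanked w r t (subdivider-end _ _ X∈sub) wk q′
      ...   | a , b , a∈ , b∈ , a≢b , flanked
        with flanked-unique (subdivider-end _ _ X∈sub) a≢b flanked (proj₁ (subdivider-flanked s w h X∈sub))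
      ...     | inj₁ refl = s∉ a∈
      ...     | inj₂ refl = s∉ b∈

  module _ {T : LabGraph m} (E : OrientedEmbedding T U′) where

    open OrientedEmbedding E

    private
      route-end-flanked : ∀ a b h {X} → X ≡ u ⊎ X ≡ v → X ∈ expand-interior (φ a) (route a b h) (φ b) →
        ∃ λ s → ∃ λ s′ → s ∈ path a b h × s′ ∈ path a b h × s ≢ s′ × Flanked X s s′
      route-end-flanked a b h end = end∈expand⇒flanked _ _ _ end (proj₁ (route-path a b h))

    expand : OrientedEmbedding T U
    expand = record
      { φ           = ι ∘ φ
      ; φ-inj       = φ-inj ∘ ι-inj
      ; φ-leaf      = λ ℓ → trans (cong ι (φ-leaf ℓ)) (ι-leaf ℓ)
      ; route       = λ a b h → expand-interior (φ a) (route a b h) (φ b)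
      ; route-path  = λ a b h → expand-walk _ _ _ (proj₁ (route-path a b h)) ,
                                Unique-expand _ _ _ (proj₂ (route-path a b h)) (proj₁ (route-path a b h))
      ; route-avoid = avoid
      ; route-disj  = disjoint
      }
      where
        avoid : ∀ a b h w → w ∈ expand-interior (φ a) (route a b h) (φ b) → ∀ t → ι (φ t) ≢ w
        avoid a b h w p t e with ∈-expand⁻ _ _ _ p
        ... | inj₁ (z , z∈r , w≡z) = route-avoid a b h z z∈r t (ι-inj (trans e w≡z))
        ... | inj₂ end             = ι≢end (φ t) end e
        -- An end shared by two routes would be flanked by the same two images on both paths.
        disjoint : ∀ a b c d (h : Adj (adj T) a b) (h′ : Adj (adj T) c d) → ¬ SameEdge a b c d → ∀ w →
          w ∈ expand-interior (φ a) (route a b h) (φ b) → w ∈ expand-interior (φ c) (route c d h′) (φ d) → ⊥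
        disjoint a b c d h h′ ¬same w p q with ∈-expand⁻ _ _ _ p | ∈-expand⁻ _ _ _ q
        ... | inj₁ (z , z∈r , e) | inj₁ (z′ , z′∈r′ , e′) =
          route-disj a b c d h h′ ¬same z z∈r (subst (_∈ route c d h′) (ι-inj (trans (sym e′) e)) z′∈r′)
        ... | inj₁ (z , _ , e) | inj₂ end = ι≢end z end (sym e)
        ... | inj₂ end | _
          with route-end-flanked a b h end p | route-end-flanked c d h′ end q
        ... | s₁ , s₁′ , s₁∈ , s₁′∈ , s₁≢s₁′ , flanked₁ | s₂ , s₂′ , s₂∈ , s₂′∈ , s₂≢s₂′ , flanked₂ =
          shared-unique a b c d h h′ ¬same s₁≢s₁′
            s₁∈ (on-path₂ (flanked-unique end s₂≢s₂′ flanked₂ (proj₁ flanked₁)))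
            s₁′∈ (on-path₂ (flanked-unique end s₂≢s₂′ flanked₂ (proj₂ flanked₁)))
          where
            on-path₂ : ∀ {z} → z ≡ s₂ ⊎ z ≡ s₂′ → z ∈ path c d h′
            on-path₂ (inj₁ refl) = s₂∈
            on-path₂ (inj₂ refl) = s₂′∈

module _ {m : ℕ} {T U U′ : LabGraph m} (NT : IsNetwork T) (NU : IsNetwork U)
         {u v : Fin (n U)} (El : Eliminates U u v U′)
         (u~v : Adj (adj U) u v) (u-deg : deg (adj U) u ≡ 3) (v-deg : deg (adj U) v ≡ 3) where

  open NetworkProperties NT using () renaming (adj-sym to T-sym; adj-irrefl to T-loopless)
  open NetworkProperties NU using () renaming (adj-sym to U-sym)

  displays-after-elimination : (E : OrientedEmbedding T U) → AvoidsEdge E u v → Displays U′ T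
  displays-after-elimination E avoids =
    symmetrize T-sym T-loopless (Eliminates-sym El U-sym) (Contraction.contract El U-sym E avoids not-image)
    where
      not-image : ∀ t → OrientedEmbedding.φ E t ≢ u × OrientedEmbedding.φ E t ≢ v
      not-image t = avoided-edge-end-not-image E NT NU avoids (inj₁ (refl , refl)) u~v u-deg t ,
                    avoided-edge-end-not-image E NT NU avoids (inj₂ (refl , refl)) (U-sym u~v) v-deg t

  displays-before-elimination : Displays U′ T → Displays U T
  displays-before-elimination E′ =
    symmetrize T-sym T-loopless U-sym (Expansion.expand El NU u-deg v-deg u~v (forget-orientation E′))

record Spine {m : ℕ} (U : LabGraph m) (x y z : Fin m) : Set where
  field
    P₀ P₁ P₂ P₃ : Fin (n U)
    P₀≢P₁ : P₀ ≢ P₁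
    P₀≢P₂ : P₀ ≢ P₂
    P₁≢P₂ : P₁ ≢ P₂
    P₁≢P₃ : P₁ ≢ P₃
    P₂≢P₃ : P₂ ≢ P₃
    P₀~P₁ : Adj (adj U) P₀ P₁
    P₁~P₂ : Adj (adj U) P₁ P₂
    P₂~P₃ : Adj (adj U) P₂ P₃
    P₁~x  : Adj (adj U) P₁ (leaf U x)
    P₂~y  : Adj (adj U) P₂ (leaf U y)
    P₃~z  : Adj (adj U) P₃ (leaf U z)
    P₀-deg : deg (adj U) P₀ ≡ 3

module SpineFacts {m : ℕ} {U : LabGraph m} (NU : IsNetwork U) {x y z : Fin m} (Sp : Spine U x y z) where

  open Spine Sp public
  open NetworkProperties NU

  P₁-deg : deg (adj U) P₁ ≡ 3
  P₁-deg = two-neighbours⇒deg≡3 P₁ P₀≢P₂ (adj-sym P₀~P₁) P₁~P₂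

  P₂-deg : deg (adj U) P₂ ≡ 3
  P₂-deg = two-neighbours⇒deg≡3 P₂ P₁≢P₃ (adj-sym P₁~P₂) P₂~P₃

  P₃-deg : deg (adj U) P₃ ≡ 3
  P₃-deg = two-neighbours⇒deg≡3 P₃ (deg≡3⇒≢leaf z P₂-deg ∘ sym) (adj-sym P₂~P₃) P₃~z

  P₁-neighbours : ∀ {w} → Adj (adj U) P₁ w → w ≡ P₀ ⊎ w ≡ P₂ ⊎ w ≡ leaf U x
  P₁-neighbours = deg≡3⇒adj-cases (adj U) P₁ P₁-deg P₀≢P₂ (deg≡3⇒≢leaf x P₀-deg ∘ sym)
    (deg≡3⇒≢leaf x P₂-deg ∘ sym) (adj-sym P₀~P₁) P₁~P₂ P₁~x

  P₂-neighbours : ∀ {w} → Adj (adj U) P₂ w → w ≡ P₁ ⊎ w ≡ P₃ ⊎ w ≡ leaf U y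
  P₂-neighbours = deg≡3⇒adj-cases (adj U) P₂ P₂-deg P₁≢P₃ (deg≡3⇒≢leaf y P₁-deg ∘ sym)
    (deg≡3⇒≢leaf y P₃-deg ∘ sym) (adj-sym P₁~P₂) P₂~P₃ P₂~y

  x-next : ∀ {w} → Adj (adj U) (leaf U x) w → w ≡ P₁
  x-next h = leaf-adj-unique x h (adj-sym P₁~x)

  y-next : ∀ {w} → Adj (adj U) (leaf U y) w → w ≡ P₂
  y-next h = leaf-adj-unique y h (adj-sym P₂~y)

  z-next : ∀ {w} → Adj (adj U) (leaf U z) w → w ≡ P₃
  z-next h = leaf-adj-unique z h (adj-sym P₃~z)

-- The rerouted embedding moves the cherry to P₂ and the stem to P₃, and continues from P₃ along
-- the old path from z to the stem.
module Rerouting {m : ℕ} {T U : LabGraph m} (NT : IsNetwork T) (NU : IsNetwork U)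
  {x y z : Fin m} (x≢y : x ≢ y) (x≢z : x ≢ z) (y≢z : y ≢ z) (S : CherryShape T x y z) (Sp : Spine U x y z)
  (E : Embedding T U)
  (φcherry≡P₁ : Embedding.φ E (CherryShape.cherry S) ≡ Spine.P₁ Sp)
  (route-cherry-y : Embedding.route E (CherryShape.cherry S) (leaf T y) (CherryShape.cherry~y S) ≡ [ Spine.P₂ Sp ])
  (z~stem : Adj (adj T) (leaf T z) (CherryShape.stem S))
  (z-exit≡P₃ : headOr (Embedding.route E (leaf T z) (CherryShape.stem S) z~stem)
                          (Embedding.φ E (CherryShape.stem S)) ≡ Spine.P₃ Sp) where

  open CherryFacts NT x≢y x≢z y≢z S
  open SpineFacts NU Sp
  open Embedding E
  open OrientedEmbedding (forget-orientation E) using (path; ∈-path⁻)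
  open NetworkProperties NT using () renaming (adj-sym to T-sym; adj⇒≢ to T-adj⇒≢; leaf-≢ to T-leaf-≢)
  open NetworkProperties NU using () renaming (adj-sym to U-sym; deg≡3⇒≢leaf to U-deg≡3⇒≢leaf)

  private
    R = route lz stem z~stem
    -- the part of the path from z to the stem after P₃
    K = drop 1 (R ++ [ φ stem ])

    P₂~P₁ : Adj (adj U) P₂ P₁
    P₂~P₁ = U-sym P₁~P₂

    R-split : R ++ [ φ stem ] ≡ P₃ ∷ K
    R-split = trans (headOr-∷-drop R (φ stem)) (cong (_∷ K) z-exit≡P₃)

    P₂∈route : P₂ ∈ route cherry ly cherry~y
    P₂∈route = subst (P₂ ∈_) (sym route-cherry-y) (here refl)

    P₃-on-R : P₃ ≡ φ stem ⊎ P₃ ∈ R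
    P₃-on-R with headOr-cases R (φ stem)
    ... | inj₁ e = inj₁ (trans (sym z-exit≡P₃) e)
    ... | inj₂ p = inj₂ (subst (_∈ R) z-exit≡P₃ p)

    ∈K⁻ : ∀ {w} → w ∈ K → w ∈ R ⊎ w ≡ φ stem
    ∈K⁻ {w} p with ∈-++⁻ R (subst (w ∈_) (sym R-split) (there p))
    ... | inj₁ q        = inj₁ q
    ... | inj₂ (here e) = inj₂ e

    R-unique : Unique (R ++ [ φ stem ])
    R-unique = Unique-tail (proj₂ (route-path lz stem z~stem))

    P₃∉K : P₃ ∉ K
    P₃∉K = Unique-head (subst Unique R-split R-unique)

    P₂-not-image : ∀ s → φ s ≢ P₂
    P₂-not-image s = route-avoid cherry ly cherry~y P₂ P₂∈route s

    P₃-not-image : ∀ s → s ≢ stem → φ s ≢ P₃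
    P₃-not-image s s≢stem e with P₃-on-R
    ... | inj₁ e′ = s≢stem (φ-inj (trans e e′))
    ... | inj₂ q  = route-avoid lz stem z~stem P₃ q s e

    z≢stem : lz ≢ stem
    z≢stem = leaf≢stem z

  φ′ : Fin (n T) → Fin (n U)
  φ′ s with s ≟ cherry | s ≟ stem
  ... | yes _ | _     = P₂
  ... | no _  | yes _ = P₃
  ... | no _  | no _  = φ s

  φ′-cases : ∀ s → (s ≡ cherry × φ′ s ≡ P₂) ⊎ (s ≡ stem × φ′ s ≡ P₃) ⊎ (s ≢ cherry × s ≢ stem × φ′ s ≡ φ s)
  φ′-cases s with s ≟ cherry | s ≟ stem
  ... | yes e   | _      = inj₁ (e , refl)
  ... | no _    | yes e  = inj₂ (inj₁ (e , refl))
  ... | no s≢c  | no s≢d = inj₂ (inj₂ (s≢c , s≢d , refl))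

  φ′-cherry : φ′ cherry ≡ P₂
  φ′-cherry with φ′-cases cherry
  ... | inj₁ (_ , e)              = e
  ... | inj₂ (inj₁ (e , _))       = ⊥-elim (cherry≢stem e)
  ... | inj₂ (inj₂ (c≢c , _ , _)) = ⊥-elim (c≢c refl)

  φ′-stem : φ′ stem ≡ P₃
  φ′-stem with φ′-cases stem
  ... | inj₁ (e , _)              = ⊥-elim (cherry≢stem (sym e))
  ... | inj₂ (inj₁ (_ , e))       = e
  ... | inj₂ (inj₂ (_ , d≢d , _)) = ⊥-elim (d≢d refl)

  φ′-other : ∀ s → s ≢ cherry → s ≢ stem → φ′ s ≡ φ s
  φ′-other s s≢c s≢d with φ′-cases s
  ... | inj₁ (e , _)              = ⊥-elim (s≢c e)
  ... | inj₂ (inj₁ (e , _))       = ⊥-elim (s≢d e)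
  ... | inj₂ (inj₂ (_ , _ , e))   = e

  φ′-leaf : ∀ ℓ → φ′ (leaf T ℓ) ≡ leaf U ℓ
  φ′-leaf ℓ = trans (φ′-other _ (leaf≢cherry ℓ) (leaf≢stem ℓ)) (φ-leaf ℓ)

  φ′-inj : ∀ {s s′} → φ′ s ≡ φ′ s′ → s ≡ s′
  φ′-inj {s} {s′} e with φ′-cases s | φ′-cases s′
  ... | inj₁ (refl , _)          | inj₁ (refl , _)          = refl
  ... | inj₂ (inj₁ (refl , _))   | inj₂ (inj₁ (refl , _))   = refl
  ... | inj₁ (_ , a)             | inj₂ (inj₁ (_ , b))      = ⊥-elim (P₂≢P₃ (trans (sym a) (trans e b)))
  ... | inj₂ (inj₁ (_ , a))      | inj₁ (_ , b)             = ⊥-elim (P₂≢P₃ (trans (sym b) (trans (sym e) a)))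
  ... | inj₁ (_ , a)             | inj₂ (inj₂ (_ , _ , b))  = ⊥-elim (P₂-not-image s′ (trans (sym b) (trans (sym e) a)))
  ... | inj₂ (inj₂ (_ , _ , b))  | inj₁ (_ , a)             = ⊥-elim (P₂-not-image s (trans (sym b) (trans e a)))
  ... | inj₂ (inj₁ (_ , a))      | inj₂ (inj₂ (_ , s′≢d , b)) = ⊥-elim (P₃-not-image s′ s′≢d (trans (sym b) (trans (sym e) a)))
  ... | inj₂ (inj₂ (_ , s≢d , b)) | inj₂ (inj₁ (_ , a))     = ⊥-elim (P₃-not-image s s≢d (trans (sym b) (trans e a)))
  ... | inj₂ (inj₂ (_ , _ , a))  | inj₂ (inj₂ (_ , _ , b))  = φ-inj (trans (sym a) (trans e b))

  φ′≢P₁ : ∀ s → φ′ s ≢ P₁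
  φ′≢P₁ s e with φ′-cases s
  ... | inj₁ (_ , a)                = P₁≢P₂ (trans (sym e) a)
  ... | inj₂ (inj₁ (_ , a))         = P₁≢P₃ (trans (sym e) a)
  ... | inj₂ (inj₂ (s≢c , _ , a))   = s≢c (φ-inj (trans (sym a) (trans e (sym φcherry≡P₁))))

  data Kind : Fin (n T) → Fin (n T) → Set where
    cherry-x    : Kind cherry lx
    cherry-y    : Kind cherry ly
    cherry-stem : Kind cherry stem
    stem-z      : Kind stem lz
    stem-third  : ∀ {t} → Adj (adj T) stem t → t ≢ cherry → t ≢ lz → Kind stem t
    untouched   : ∀ {a b} → Adj (adj T) a b → a ≢ cherry → a ≢ stem → b ≢ cherry → b ≢ stem → Kind a b

  cherry-kind : ∀ {b} → b ≡ lx ⊎ b ≡ ly ⊎ b ≡ stem → Kind cherry b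
  cherry-kind (inj₁ refl)        = cherry-x
  cherry-kind (inj₂ (inj₁ refl)) = cherry-y
  cherry-kind (inj₂ (inj₂ refl)) = cherry-stem

  kind : ∀ a b → Adj (adj T) a b → Kind a b ⊎ Kind b a
  kind a b h with a ≟ cherry | b ≟ cherry | a ≟ stem | b ≟ stem
  ... | yes refl | _        | _        | _ = inj₁ (cherry-kind (cherry-neighbours h))
  ... | no _     | yes refl | _        | _ = inj₂ (cherry-kind (cherry-neighbours (T-sym h)))
  ... | no a≢c   | no b≢c   | yes refl | _ with b ≟ lz
  ...   | yes refl = inj₁ stem-z
  ...   | no b≢z   = inj₁ (stem-third h b≢c b≢z)
  kind a b h | no a≢c | no b≢c | no _ | yes refl with a ≟ lz
  ...   | yes refl = inj₂ stem-z
  ...   | no a≢z   = inj₂ (stem-third (T-sym h) a≢c a≢z)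
  kind a b h | no a≢c | no b≢c | no a≢d | no b≢d = inj₁ (untouched h a≢c a≢d b≢c b≢d)

  new-route : ∀ {a b} → Kind a b → List (Fin (n U))
  new-route cherry-x               = [ P₁ ]
  new-route cherry-y               = []
  new-route cherry-stem            = []
  new-route stem-z                 = []
  new-route (stem-third {t} h _ _) = K ++ route stem t h
  new-route (untouched {a} {b} h _ _ _ _) = route a b h

  private
    P₁-not-image-of : ∀ {s} → s ≢ cherry → φ s ≢ P₁
    P₁-not-image-of s≢c e = s≢c (φ-inj (trans e (sym φcherry≡P₁)))

    R-path-disjoint : ∀ {t} (h : Adj (adj T) stem t) → t ≢ lz → Disjoint R (path stem t h)
    R-path-disjoint {t} h t≢z {w} (w∈R , w∈path) with ∈-path⁻ stem t h w∈path
    ... | inj₁ e        = route-avoid lz stem z~stem w w∈R stem (sym e)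
    ... | inj₂ (inj₁ q) = route-disj lz stem stem t z~stem h ¬same w w∈R q
      where
        ¬same : ¬ SameEdge lz stem stem t
        ¬same (inj₁ (z≡d , _)) = z≢stem z≡d
        ¬same (inj₂ (z≡t , _)) = t≢z (sym z≡t)
    ... | inj₂ (inj₂ e) = route-avoid lz stem z~stem w w∈R t (sym e)

    stem-third-path : ∀ {t} (h : Adj (adj T) stem t) → P₃ ∷ (K ++ route stem t h) ++ [ φ t ] ≡ R ++ path stem t h
    stem-third-path {t} h = begin
      P₃ ∷ (K ++ route stem t h) ++ [ φ t ]    ≡⟨ cong (P₃ ∷_) (++-assoc K (route stem t h) [ φ t ]) ⟩
      (P₃ ∷ K) ++ route stem t h ++ [ φ t ]    ≡⟨ cong (_++ (route stem t h ++ [ φ t ])) (sym R-split) ⟩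
      (R ++ [ φ stem ]) ++ route stem t h ++ [ φ t ] ≡⟨ ++-assoc R [ φ stem ] _ ⟩
      R ++ path stem t h                       ∎
      where open ≡-Reasoning

  new-path : ∀ {a b} (k : Kind a b) →
    IsWalk (adj U) (φ′ a ∷ new-route k ++ [ φ′ b ]) × Unique (φ′ a ∷ new-route k ++ [ φ′ b ])
  new-path cherry-x rewrite φ′-cherry | φ′-leaf x =
    (P₂~P₁ , P₁~x , tt) ,
    (P₁≢P₂ ∘ sym ∷ P₂≢x ∷ []) ∷ (P₁≢x ∷ []) ∷ [] ∷ []
    where
      P₂≢x : P₂ ≢ leaf U x
      P₂≢x e = P₂-not-image lx (trans (φ-leaf x) (sym e))
      P₁≢x : P₁ ≢ leaf U x
      P₁≢x e = P₁-not-image-of (leaf≢cherry x) (trans (φ-leaf x) (sym e))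
  new-path cherry-y rewrite φ′-cherry | φ′-leaf y =
    (P₂~y , tt) , ((λ e → P₂-not-image ly (trans (φ-leaf y) (sym e))) ∷ []) ∷ [] ∷ []
  new-path cherry-stem rewrite φ′-cherry | φ′-stem = (P₂~P₃ , tt) , (P₂≢P₃ ∷ []) ∷ [] ∷ []
  new-path stem-z rewrite φ′-stem | φ′-leaf z =
    (P₃~z , tt) , ((λ e → P₃-not-image lz z≢stem (trans (φ-leaf z) (sym e))) ∷ []) ∷ [] ∷ []
  new-path (stem-third {t} h t≢c t≢z)
    rewrite φ′-stem | φ′-other t t≢c (T-adj⇒≢ h ∘ sym) | stem-third-path h =
    IsWalk-++ (adj U) R (route stem t h ++ [ φ t ])
      (IsWalk-tail (adj U) (R ++ [ φ stem ]) (proj₁ (route-path lz stem z~stem))) (proj₁ (route-path stem t h)) ,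
    Unique.++⁺ (Unique-++⁻ˡ R R-unique) (proj₂ (route-path stem t h)) (R-path-disjoint h t≢z)
  new-path (untouched {a} {b} h a≢c a≢d b≢c b≢d) rewrite φ′-other a a≢c a≢d | φ′-other b b≢c b≢d =
    route-path a b h

  private
    P₂∉route : ∀ a b h → ¬ SameEdge a b cherry ly → P₂ ∉ route a b h
    P₂∉route a b h ¬same p = route-disj a b cherry ly h cherry~y ¬same P₂ p P₂∈route

    P₃∉route : ∀ a b h → ¬ SameEdge a b lz stem → P₃ ∉ route a b h
    P₃∉route a b h ¬same p with P₃-on-R
    ... | inj₁ e  = route-avoid a b h P₃ p stem (sym e)
    ... | inj₂ q  = route-disj a b lz stem h z~stem ¬same P₃ p q

    old-route-avoid : ∀ a b h → ¬ SameEdge a b cherry ly → ¬ SameEdge a b lz stem →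
      ∀ {w} → w ∈ route a b h → ∀ s → φ′ s ≢ w
    old-route-avoid a b h ¬same-y ¬same-z {w} p s e with φ′-cases s
    ... | inj₁ (_ , P₂≡)            = P₂∉route a b h ¬same-y (subst (_∈ route a b h) (trans (sym e) P₂≡) p)
    ... | inj₂ (inj₁ (_ , P₃≡))     = P₃∉route a b h ¬same-z (subst (_∈ route a b h) (trans (sym e) P₃≡) p)
    ... | inj₂ (inj₂ (_ , _ , φ≡))  = route-avoid a b h w p s (trans (sym φ≡) e)

    K-avoid : ∀ {w} → w ∈ K → ∀ s → φ′ s ≢ w
    K-avoid {w} p s e with φ′-cases s | ∈K⁻ p
    ... | inj₁ (_ , P₂≡)           | inj₁ w∈R = P₂∉route lz stem z~stem ¬same (subst (_∈ R) (trans (sym e) P₂≡) w∈R)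
      where
        ¬same : ¬ SameEdge lz stem cherry ly
        ¬same (inj₁ (z≡c , _)) = leaf≢cherry z z≡c
        ¬same (inj₂ (z≡y , _)) = T-leaf-≢ y≢z (sym z≡y)
    ... | inj₁ (_ , P₂≡)           | inj₂ w≡φd = P₂-not-image stem (trans (sym w≡φd) (trans (sym e) P₂≡))
    ... | inj₂ (inj₁ (_ , P₃≡))    | _         = P₃∉K (subst (_∈ K) (trans (sym e) P₃≡) p)
    ... | inj₂ (inj₂ (_ , _ , φ≡)) | inj₁ w∈R  = route-avoid lz stem z~stem w w∈R s (trans (sym φ≡) e)
    ... | inj₂ (inj₂ (_ , s≢d , φ≡)) | inj₂ w≡φd = s≢d (φ-inj (trans (sym φ≡) (trans e w≡φd)))

  new-route-avoid : ∀ {a b} (k : Kind a b) {w} → w ∈ new-route k → ∀ s → φ′ s ≢ w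
  new-route-avoid cherry-x (here refl) s = φ′≢P₁ s
  new-route-avoid (stem-third {t} h t≢c t≢z) p s with ∈-++⁻ K p
  ... | inj₁ q = K-avoid q s
  ... | inj₂ q = old-route-avoid stem t h ¬same-y ¬same-z q s
    where
      ¬same-y : ¬ SameEdge stem t cherry ly
      ¬same-y (inj₁ (d≡c , _)) = cherry≢stem (sym d≡c)
      ¬same-y (inj₂ (d≡y , _)) = stem≢y d≡y
      ¬same-z : ¬ SameEdge stem t lz stem
      ¬same-z (inj₁ (d≡z , _)) = z≢stem (sym d≡z)
      ¬same-z (inj₂ (_ , t≡z)) = t≢z t≡z
  new-route-avoid (untouched {a} {b} h a≢c a≢d b≢c b≢d) p s = old-route-avoid a b h ¬same-y ¬same-z p s
    where
      ¬same-y : ¬ SameEdge a b cherry ly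
      ¬same-y (inj₁ (a≡c , _)) = a≢c a≡c
      ¬same-y (inj₂ (_ , b≡c)) = b≢c b≡c
      ¬same-z : ¬ SameEdge a b lz stem
      ¬same-z (inj₁ (_ , b≡d)) = b≢d b≡d
      ¬same-z (inj₂ (a≡d , _)) = a≢d a≡d

  private
    P₁∉stem-third : ∀ {t} (h : Adj (adj T) stem t) → P₁ ∉ K ++ route stem t h
    P₁∉stem-third {t} h p with ∈-++⁻ K p
    ... | inj₂ q = route-avoid stem t h P₁ q cherry φcherry≡P₁
    ... | inj₁ q with ∈K⁻ q
    ...   | inj₁ r   = route-avoid lz stem z~stem P₁ r cherry φcherry≡P₁
    ...   | inj₂ P₁≡ = cherry≢stem (φ-inj (trans φcherry≡P₁ P₁≡))

    stem-third-untouched : ∀ {t a b} (h : Adj (adj T) stem t) (h′ : Adj (adj T) a b) → a ≢ stem → b ≢ stem →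
      ∀ {w} → w ∈ K ++ route stem t h → w ∈ route a b h′ → ⊥
    stem-third-untouched {t} {a} {b} h h′ a≢d b≢d {w} p q with ∈-++⁻ K p
    ... | inj₂ p′ = route-disj stem t a b h h′ ¬same w p′ q
      where
        ¬same : ¬ SameEdge stem t a b
        ¬same (inj₁ (d≡a , _)) = a≢d (sym d≡a)
        ¬same (inj₂ (d≡b , _)) = b≢d (sym d≡b)
    ... | inj₁ p′ with ∈K⁻ p′
    ...   | inj₁ r   = route-disj lz stem a b z~stem h′ ¬same w r q
      where
        ¬same : ¬ SameEdge lz stem a b
        ¬same (inj₁ (_ , d≡b)) = b≢d (sym d≡b)
        ¬same (inj₂ (_ , d≡a)) = a≢d (sym d≡a)
    ...   | inj₂ w≡φd = route-avoid a b h′ w q stem (sym w≡φd)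

  new-routes-disjoint : ∀ {a b a′ b′} (k : Kind a b) (k′ : Kind a′ b′) → ¬ SameEdge a b a′ b′ →
    ∀ {w} → w ∈ new-route k → w ∈ new-route k′ → ⊥
  new-routes-disjoint cherry-x cherry-x ¬same _ _ = ¬same (inj₁ (refl , refl))
  new-routes-disjoint cherry-x (stem-third h _ _) _ (here refl) q = P₁∉stem-third h q
  new-routes-disjoint (stem-third h _ _) cherry-x _ p (here refl) = P₁∉stem-third h p
  new-routes-disjoint cherry-x (untouched {a} {b} h _ _ _ _) _ (here refl) q = route-avoid a b h P₁ q cherry φcherry≡P₁
  new-routes-disjoint (untouched {a} {b} h _ _ _ _) cherry-x _ p (here refl) = route-avoid a b h P₁ p cherry φcherry≡P₁
  new-routes-disjoint (stem-third h t≢c t≢z) (stem-third h′ t′≢c t′≢z) ¬same _ _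
    with stem-third-neighbour-unique h h′ t≢c t≢z t′≢c t′≢z
  ... | refl = ¬same (inj₁ (refl , refl))
  new-routes-disjoint (stem-third h _ _) (untouched h′ _ a≢d _ b≢d) _ p q = stem-third-untouched h h′ a≢d b≢d p q
  new-routes-disjoint (untouched h _ a≢d _ b≢d) (stem-third h′ _ _) _ p q = stem-third-untouched h′ h a≢d b≢d q p
  new-routes-disjoint (untouched {a} {b} h _ _ _ _) (untouched {a′} {b′} h′ _ _ _ _) ¬same p q =
    route-disj a b a′ b′ h h′ ¬same _ p q

  private
    oriented-route : ∀ {a b} → Kind a b ⊎ Kind b a → List (Fin (n U))
    oriented-route (inj₁ k) = new-route k
    oriented-route (inj₂ k) = reverse (new-route k)

    oriented-path : ∀ {a b} (κ : Kind a b ⊎ Kind b a) →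
      IsWalk (adj U) (φ′ a ∷ oriented-route κ ++ [ φ′ b ]) × Unique (φ′ a ∷ oriented-route κ ++ [ φ′ b ])
    oriented-path (inj₁ k) = new-path k
    oriented-path {a} {b} (inj₂ k) rewrite sym (reverse-path (φ′ a) (new-route k) (φ′ b)) =
      IsWalk-reverse (adj U) U-sym _ (proj₁ (new-path k)) , Unique-reverse _ (proj₂ (new-path k))

    oriented-avoid : ∀ {a b} (κ : Kind a b ⊎ Kind b a) {w} → w ∈ oriented-route κ → ∀ s → φ′ s ≢ w
    oriented-avoid (inj₁ k) p = new-route-avoid k p
    oriented-avoid (inj₂ k) p = new-route-avoid k (Anyₚ.reverse⁻ p)

    oriented-disjoint : ∀ {a b a′ b′} (κ : Kind a b ⊎ Kind b a) (κ′ : Kind a′ b′ ⊎ Kind b′ a′) →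
      ¬ SameEdge a b a′ b′ → ∀ {w} → w ∈ oriented-route κ → w ∈ oriented-route κ′ → ⊥
    oriented-disjoint (inj₁ k) (inj₁ k′) ¬same p q = new-routes-disjoint k k′ ¬same p q
    oriented-disjoint (inj₁ k) (inj₂ k′) ¬same p q =
      new-routes-disjoint k k′ (¬same ∘ SameEdge-flipʳ) p (Anyₚ.reverse⁻ q)
    oriented-disjoint (inj₂ k) (inj₁ k′) ¬same p q =
      new-routes-disjoint k k′ (¬same ∘ SameEdge-flipˡ) (Anyₚ.reverse⁻ p) q
    oriented-disjoint (inj₂ k) (inj₂ k′) ¬same p q =
      new-routes-disjoint k k′ (¬same ∘ SameEdge-flipˡ ∘ SameEdge-flipʳ)
        (Anyₚ.reverse⁻ p) (Anyₚ.reverse⁻ q)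

  rerouted : OrientedEmbedding T U
  rerouted = record
    { φ           = φ′
    ; φ-inj       = φ′-inj
    ; φ-leaf      = φ′-leaf
    ; route       = λ a b h → oriented-route (kind a b h)
    ; route-path  = λ a b h → oriented-path (kind a b h)
    ; route-avoid = λ a b h w p → oriented-avoid (kind a b h) p
    ; route-disj  = λ a b c d h h′ ¬same w p q → oriented-disjoint (kind a b h) (kind c d h′) ¬same p q
    }

  rerouted-avoids : AvoidsEdge rerouted P₀ P₁
  rerouted-avoids a b h =
    IsWalk-deleteEdge (adj U) _ (proj₁ (oriented-path (kind a b h))) (not-both (kind a b h))
    where
      P₀∉cherry-x : ∀ {w} → w ∈ P₂ ∷ P₁ ∷ [ leaf U x ] → w ≢ P₀
      P₀∉cherry-x (here refl)                 = P₀≢P₂ ∘ sym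
      P₀∉cherry-x (there (here refl))         = P₀≢P₁ ∘ sym
      P₀∉cherry-x (there (there (here refl))) = U-deg≡3⇒≢leaf x P₀-deg
      on-route : ∀ {a b} (k : Kind a b) → P₁ ∈ new-route k → P₀ ∈ φ′ a ∷ new-route k ++ [ φ′ b ] → ⊥
      on-route cherry-x _ p rewrite φ′-cherry | φ′-leaf x = P₀∉cherry-x p refl
      on-route (stem-third h _ _) q _ = P₁∉stem-third h q
      on-route (untouched {a} {b} h _ _ _ _) q _ = route-avoid a b h P₁ q cherry φcherry≡P₁
      not-both : ∀ (κ : Kind a b ⊎ Kind b a) → P₀ ∈ φ′ a ∷ oriented-route κ ++ [ φ′ b ] →
        P₁ ∈ φ′ a ∷ oriented-route κ ++ [ φ′ b ] → ⊥
      on-oriented : ∀ (κ : Kind a b ⊎ Kind b a) → P₁ ∈ oriented-route κ →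
        P₀ ∈ φ′ a ∷ oriented-route κ ++ [ φ′ b ] → ⊥
      on-oriented (inj₁ k) q p₀ = on-route k q p₀
      on-oriented (inj₂ k) q p₀ = on-route k (Anyₚ.reverse⁻ q)
        (Anyₚ.reverse⁻ (subst (P₀ ∈_) (sym (reverse-path (φ′ a) (new-route k) (φ′ b))) p₀))
      not-both κ p₀ p₁ with ∈-enclosed⁻ (oriented-route κ) p₁
      ... | inj₁ e        = φ′≢P₁ a (sym e)
      ... | inj₂ (inj₂ e) = φ′≢P₁ b (sym e)
      ... | inj₂ (inj₁ q) = on-oriented κ q p₀

module AvoidingEmbedding {m : ℕ} {T U : LabGraph m} (NT : IsNetwork T) (NU : IsNetwork U)
  {x y z : Fin m} (x≢y : x ≢ y) (x≢z : x ≢ z) (y≢z : y ≢ z)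
  (S : CherryShape T x y z) (Sp : Spine U x y z) (E : Embedding T U) where

  open CherryFacts NT x≢y x≢z y≢z S
  open SpineFacts NU Sp
  open Embedding E
  open NetworkProperties NT using () renaming (adj-sym to T-sym; adj-irrefl to T-loopless; leaf-≢ to T-leaf-≢)
  open NetworkProperties NU using () renaming (adj-sym to U-sym; deg≡3⇒≢leaf to U-deg≡3⇒≢leaf)

  E° : OrientedEmbedding T U
  E° = forget-orientation E

  open OrientedEmbedding E°
    using (path; ∈-path⁻; exit; exit-adj; exit-injective; Beyond; exit-beyond; exit-≢-image; route-vs-beyond; beyond-vs-beyond)

  Result : Set
  Result = Σ (OrientedEmbedding T U) λ E′ → AvoidsEdge E′ P₀ P₁

  private
    x~cherry : Adj (adj T) lx cherry
    x~cherry = T-sym cherry~x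

    y~cherry : Adj (adj T) ly cherry
    y~cherry = T-sym cherry~y

    z~stem : Adj (adj T) lz stem
    z~stem = T-sym stem~z

    leaf-exit : ∀ ℓ {a} h {P} → (∀ {w} → Adj (adj U) (leaf U ℓ) w → w ≡ P) → exit (leaf T ℓ) a h ≡ P
    leaf-exit ℓ h ℓ-exit = ℓ-exit (subst (λ v → Adj (adj U) v _) (φ-leaf ℓ) (exit-adj _ _ h))

    exit-from-P : ∀ t a h {P} → φ t ≡ P → Adj (adj U) P (exit t a h)
    exit-from-P t a h φt≡P = subst (λ v → Adj (adj U) v (exit t a h)) φt≡P (exit-adj t a h)

    ∈-route-reversed : ∀ a b h h′ {w} → w ∈ route b a h′ → w ∈ route a b h
    ∈-route-reversed a b h h′ {w} p = Anyₚ.reverse⁻ (subst (w ∈_) (route-sym a b h h′) p)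

    φ-leaf≢ : ∀ ℓ {P} → deg (adj U) P ≡ 3 → φ (leaf T ℓ) ≢ P
    φ-leaf≢ ℓ P-deg e = U-deg≡3⇒≢leaf ℓ P-deg (trans (sym (φ-leaf ℓ)) e)

    path-unique : ∀ a b h → Unique (path a b h)
    path-unique a b h = proj₂ (route-path a b h)

    P₂-on-y-route : φ cherry ≢ P₂ → P₂ ∈ route cherry ly cherry~y
    P₂-on-y-route φc≢P₂ with exit-beyond ly cherry y~cherry | leaf-exit y y~cherry y-next
    ... | inj₁ e | exit≡P₂ = ⊥-elim (φc≢P₂ (trans (sym e) exit≡P₂))
    ... | inj₂ p | exit≡P₂ = ∈-route-reversed cherry ly cherry~y y~cherry (subst (_∈ route ly cherry y~cherry) exit≡P₂ p)

    ¬same-cherry-y-stem : ¬ SameEdge cherry ly cherry stem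
    ¬same-cherry-y-stem (inj₁ (_ , y≡stem))    = leaf≢stem y y≡stem
    ¬same-cherry-y-stem (inj₂ (c≡stem , _))    = cherry≢stem c≡stem

  -- If the cherry sits at P₁, the route to y cannot leave through P₀: the route to the stem would
  -- then have no free neighbour of P₁ left.
  y-route-avoids-P₀ : φ cherry ≡ P₁ → exit cherry ly cherry~y ≢ P₀
  y-route-avoids-P₀ φc≡P₁ exit≡P₀ with P₁-neighbours (exit-from-P cherry stem cherry~stem φc≡P₁)
  ... | inj₁ e        = exit-injective T-loopless cherry ly stem cherry~y cherry~stem (leaf≢stem y) (trans exit≡P₀ (sym e))
  ... | inj₂ (inj₁ e) =
    route-vs-beyond cherry ly cherry stem cherry~y cherry~stem ¬same-cherry-y-stem
      (P₂-on-y-route (λ φc≡P₂ → P₁≢P₂ (trans (sym φc≡P₁) φc≡P₂)))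
      (subst (Beyond cherry stem cherry~stem) e (exit-beyond cherry stem cherry~stem))
  ... | inj₂ (inj₂ e) = exit-≢-image cherry stem cherry~stem (leaf≢stem x) (trans e (sym (φ-leaf x)))

  y-route-is-P₂ : φ cherry ≡ P₁ → exit cherry ly cherry~y ≡ P₂ → route cherry ly cherry~y ≡ [ P₂ ]
  y-route-is-P₂ φc≡P₁ exit≡P₂ =
    first≡last⇒singleton (route cherry ly cherry~y) (Unique-++⁻ˡ _ (Unique-tail (path-unique cherry ly cherry~y)))
      exit≡P₂ last≡P₂ (φ-leaf≢ y P₂-deg)
    where
      last≡P₂ : headOr (reverse (route cherry ly cherry~y)) (φ cherry) ≡ P₂
      last≡P₂ = trans (cong (λ l → headOr l (φ cherry)) (sym (route-sym cherry ly cherry~y y~cherry)))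
                      (leaf-exit y y~cherry y-next)

  cherry-at-P₁ : φ cherry ≡ P₁ → Result
  cherry-at-P₁ φc≡P₁ with P₁-neighbours (exit-from-P cherry ly cherry~y φc≡P₁)
  ... | inj₁ e        = ⊥-elim (y-route-avoids-P₀ φc≡P₁ e)
  ... | inj₂ (inj₂ e) = ⊥-elim (exit-≢-image cherry ly cherry~y (T-leaf-≢ x≢y) (trans e (sym (φ-leaf x))))
  ... | inj₂ (inj₁ e) = rerouted , rerouted-avoids
    where
      open Rerouting NT NU x≢y x≢z y≢z S Sp E φc≡P₁ (y-route-is-P₂ φc≡P₁ e) z~stem (leaf-exit z z~stem z-next)

  private
    D = deleteEdge (adj U) P₀ P₁

    x-path≡ : ∀ r → route lx cherry x~cherry ≡ P₁ ∷ r →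
      path lx cherry x~cherry ≡ φ lx ∷ P₁ ∷ headOr r (φ cherry) ∷ drop 1 (r ++ [ φ cherry ])
    x-path≡ r route≡ rewrite route≡ = cong (λ l → φ lx ∷ P₁ ∷ l) (headOr-∷-drop r (φ cherry))

    x-path-walk : ∀ r → route lx cherry x~cherry ≡ P₁ ∷ r → IsWalk (adj U) (φ lx ∷ P₁ ∷ r ++ [ φ cherry ])
    x-path-walk r route≡ =
      subst (λ l → IsWalk (adj U) (φ lx ∷ l ++ [ φ cherry ])) route≡ (proj₁ (route-path lx cherry x~cherry))

    x-path-unique : ∀ r → route lx cherry x~cherry ≡ P₁ ∷ r → Unique (φ lx ∷ P₁ ∷ r ++ [ φ cherry ])
    x-path-unique r route≡ = subst (λ l → Unique (φ lx ∷ l ++ [ φ cherry ])) route≡ (path-unique lx cherry x~cherry)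

    x-path-avoids : ∀ r → route lx cherry x~cherry ≡ P₁ ∷ r → headOr r (φ cherry) ≡ P₂ →
      IsWalk D (path lx cherry x~cherry)
    x-path-avoids r route≡ third≡P₂ rewrite x-path≡ r route≡ =
      deleteEdge-keeps (adj U) P₀ P₁ (proj₁ walk) not-this-edge ,
      IsWalk-deleteEdge-from (adj U) _ (proj₂ walk) (Unique-head (Unique-tail uq)) (λ e → P₀≢P₂ (trans (sym e) third≡P₂))
      where
        walk = subst (IsWalk (adj U)) (x-path≡ r route≡) (proj₁ (route-path lx cherry x~cherry))
        uq = subst Unique (x-path≡ r route≡) (path-unique lx cherry x~cherry)
        not-this-edge : ¬ SameEdge (φ lx) P₁ P₀ P₁
        not-this-edge (inj₁ (φx≡P₀ , _)) = φ-leaf≢ x P₀-deg φx≡P₀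
        not-this-edge (inj₂ (φx≡P₁ , _)) = φ-leaf≢ x P₁-deg φx≡P₁

  x-route-via-P₂-avoids : ∀ r → route lx cherry x~cherry ≡ P₁ ∷ r → headOr r (φ cherry) ≡ P₂ → AvoidsEdge E° P₀ P₁
  x-route-via-P₂-avoids r route≡ third≡P₂ a b h with sameEdge? a b lx cherry
  ... | yes (inj₁ (refl , refl)) rewrite Adj-irrelevant (adj T) h x~cherry = x-path-avoids r route≡ third≡P₂
  ... | yes (inj₂ (refl , refl))
    rewrite route-sym lx cherry x~cherry h | sym (reverse-path (φ cherry) (route lx cherry x~cherry) (φ lx)) =
    IsWalk-reverse D (deleteEdge-sym (adj U) P₀ P₁ U-sym) _ (x-path-avoids r route≡ third≡P₂)
  ... | no ¬same = IsWalk-deleteEdge (adj U) _ (proj₁ (route-path a b h)) (λ _ → P₁∉path)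
    where
      P₁∈x-route : P₁ ∈ route lx cherry x~cherry
      P₁∈x-route = subst (P₁ ∈_) (sym route≡) (here refl)
      P₁∉path : P₁ ∉ path a b h
      P₁∉path p with ∈-path⁻ a b h p
      ... | inj₁ e        = route-avoid lx cherry x~cherry P₁ P₁∈x-route a (sym e)
      ... | inj₂ (inj₁ q) = route-disj lx cherry a b x~cherry h (¬same ∘ SameEdge-sym) P₁ P₁∈x-route q
      ... | inj₂ (inj₂ e) = route-avoid lx cherry x~cherry P₁ P₁∈x-route b (sym e)

  private
    P₁∈x-route : ∀ r → route lx cherry x~cherry ≡ P₁ ∷ r → P₁ ∈ route lx cherry x~cherry
    P₁∈x-route r route≡ = subst (P₁ ∈_) (sym route≡) (here refl)

    ¬same-x-y : ¬ SameEdge lx cherry ly cherry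
    ¬same-x-y (inj₁ (x≡y , _)) = T-leaf-≢ x≢y x≡y
    ¬same-x-y (inj₂ (x≡c , _)) = leaf≢cherry x x≡c

    ¬same-y-z : ¬ SameEdge ly cherry lz stem
    ¬same-y-z (inj₁ (y≡z , _)) = T-leaf-≢ y≢z y≡z
    ¬same-y-z (inj₂ (y≡stem , _)) = leaf≢stem y y≡stem

    ¬same-cherry-x-stem : ¬ SameEdge cherry lx cherry stem
    ¬same-cherry-x-stem (inj₁ (_ , x≡stem)) = leaf≢stem x x≡stem
    ¬same-cherry-x-stem (inj₂ (c≡stem , _)) = cherry≢stem c≡stem

    beyond-P₂ : ∀ r′ → route ly cherry y~cherry ≡ P₂ ∷ r′ → Beyond ly cherry y~cherry (headOr r′ (φ cherry))
    beyond-P₂ r′ route-y≡ with headOr-cases r′ (φ cherry)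
    ... | inj₁ e = inj₁ e
    ... | inj₂ p = inj₂ (subst (_ ∈_) (sym route-y≡) (there p))

  -- Once the route from x has passed P₁ on its way to the cherry, the route from y can only enter
  -- P₂ and stop: P₂'s other neighbours are P₁, taken by the route from x, and P₃, taken by z's.
  y-route-is-direct : ∀ r → route lx cherry x~cherry ≡ P₁ ∷ r → ∀ r′ → route ly cherry y~cherry ≢ P₂ ∷ r′
  y-route-is-direct r route≡ r′ route-y≡
    with P₂-neighbours (IsWalk-headOr (adj U) P₂ r′ (φ cherry)
           (proj₂ (subst (λ l → IsWalk (adj U) (φ ly ∷ l ++ [ φ cherry ])) route-y≡ (proj₁ (route-path ly cherry y~cherry)))))
  ... | inj₁ e = route-vs-beyond lx cherry ly cherry x~cherry y~cherry ¬same-x-y (P₁∈x-route r route≡)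
                   (subst (Beyond ly cherry y~cherry) e (beyond-P₂ r′ route-y≡))
  ... | inj₂ (inj₁ e) = beyond-vs-beyond ly cherry lz stem y~cherry z~stem ¬same-y-z cherry≢stem
                          (subst (Beyond ly cherry y~cherry) e (beyond-P₂ r′ route-y≡))
                          (subst (Beyond lz stem z~stem) (leaf-exit z z~stem z-next) (exit-beyond lz stem z~stem))
  ... | inj₂ (inj₂ e) =
    Unique-head (subst (λ l → Unique (φ ly ∷ l ++ [ φ cherry ])) route-y≡ (path-unique ly cherry y~cherry))
      (there (subst (_∈ r′ ++ [ φ cherry ]) (trans e (sym (φ-leaf y))) (headOr-∈ r′ (φ cherry) [])))

  -- With the cherry at P₂, its three routes leave through P₁, P₃ and y; the stem's must take P₃
  -- because P₁ is on the route to x, so x's route would have to leave through P₁ as well, but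
  -- that route reaches P₁ only after P₀.
  cherry-not-at-P₂ : ∀ r → route lx cherry x~cherry ≡ P₁ ∷ r → headOr r (φ cherry) ≡ P₀ → φ cherry ≢ P₂
  cherry-not-at-P₂ r route≡ third≡P₀ φc≡P₂ with P₂-neighbours (exit-from-P cherry stem cherry~stem φc≡P₂)
  ... | inj₁ e        = route-vs-beyond cherry lx cherry stem cherry~x cherry~stem ¬same-cherry-x-stem
                          P₁∈cherry-route (subst (Beyond cherry stem cherry~stem) e (exit-beyond cherry stem cherry~stem))
    where
      P₁∈cherry-route = ∈-route-reversed cherry lx cherry~x x~cherry (P₁∈x-route r route≡)
  ... | inj₂ (inj₂ e) = exit-≢-image cherry stem cherry~stem (leaf≢stem y) (trans e (sym (φ-leaf y)))
  ... | inj₂ (inj₁ stem-exit≡P₃) with P₂-neighbours (exit-from-P cherry lx cherry~x φc≡P₂)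
  ...   | inj₂ (inj₁ e) = exit-injective T-loopless cherry lx stem cherry~x cherry~stem (leaf≢stem x) (trans e (sym stem-exit≡P₃))
  ...   | inj₂ (inj₂ e) = exit-≢-image cherry lx cherry~x (T-leaf-≢ (x≢y ∘ sym)) (trans e (sym (φ-leaf y)))
  ...   | inj₁ e =
    Unique-head (Unique-tail (x-path-unique r route≡))
      (∈-++⁺ˡ {ys = [ φ cherry ]} (Anyₚ.reverse⁻ {xs = r} (subst (_∈ reverse r) (trans (sym (exit-is-last-of-r)) e) (headOr-∈-nonempty (reverse r) P₁ P₀∈r))))
    where
      P₀∈r : P₀ ∈ reverse r
      P₀∈r with headOr-cases r (φ cherry)
      ... | inj₁ e′ = ⊥-elim (P₀≢P₂ (trans (sym third≡P₀) (trans e′ φc≡P₂)))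
      ... | inj₂ p  = Anyₚ.reverse⁺ (subst (_∈ r) third≡P₀ p)
      exit-is-last-of-r : exit cherry lx cherry~x ≡ headOr (reverse r) P₁
      exit-is-last-of-r = begin
        headOr (route cherry lx cherry~x) (φ lx) ≡⟨ cong (λ l → headOr l (φ lx)) (route-sym lx cherry x~cherry cherry~x) ⟩
        headOr (reverse (route lx cherry x~cherry)) (φ lx) ≡⟨ cong (λ l → headOr (reverse l) (φ lx)) route≡ ⟩
        headOr (reverse (P₁ ∷ r)) (φ lx) ≡⟨ cong (λ l → headOr l (φ lx)) (unfold-reverse P₁ r) ⟩
        headOr (reverse r ++ [ P₁ ]) (φ lx) ≡⟨ headOr-∷ʳ (reverse r) P₁ (φ lx) ⟩
        headOr (reverse r) P₁ ∎
        where open ≡-Reasoning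

  x-route-avoids-P₀ : ∀ r → route lx cherry x~cherry ≡ P₁ ∷ r → headOr r (φ cherry) ≢ P₀
  x-route-avoids-P₀ r route≡ third≡P₀
    with headOr-view (route ly cherry y~cherry) (φ cherry) (leaf-exit y y~cherry y-next)
  ... | inj₁ (_ , φc≡P₂)    = cherry-not-at-P₂ r route≡ third≡P₀ φc≡P₂
  ... | inj₂ (r′ , route-y≡) = y-route-is-direct r route≡ r′ route-y≡

  avoiding-embedding : Result
  avoiding-embedding with headOr-view (route lx cherry x~cherry) (φ cherry) (leaf-exit x x~cherry x-next)
  ... | inj₁ (_ , φc≡P₁) = cherry-at-P₁ φc≡P₁
  ... | inj₂ (r , route≡) with P₁-neighbours (IsWalk-headOr (adj U) P₁ r (φ cherry) (proj₂ (x-path-walk r route≡)))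
  ...   | inj₁ e        = ⊥-elim (x-route-avoids-P₀ r route≡ e)
  ...   | inj₂ (inj₁ e) = E° , x-route-via-P₂-avoids r route≡ e
  ...   | inj₂ (inj₂ e) = ⊥-elim (Unique-head (x-path-unique r route≡)
                            (there (subst (_∈ r ++ [ φ cherry ]) (trans e (sym (φ-leaf x))) (headOr-∈ r (φ cherry) []))))

lemma12 : ∀ {m : ℕ} (T U : LabGraph m) →
  3 < m → IsTree T → IsNetwork U → ThreeCuttable U →
  (x y z : Fin m) → x ≢ y → x ≢ z → y ≢ z →
  (P : Fin 4 → Fin (n U)) → Injective _≡_ _≡_ P →
  Adj (adj U) (P zero) (P (suc zero)) →
  Adj (adj U) (P (suc zero)) (P (suc (suc zero))) →
  Adj (adj U) (P (suc (suc zero))) (P (suc (suc (suc zero)))) →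
  CutEdge U (P (suc zero)) (leaf U x) →
  CutEdge U (P (suc (suc zero))) (leaf U y) →
  CutEdge U (P (suc (suc (suc zero)))) (leaf U z) →
  (∀ i j → ¬ CutEdge U (P i) (P j)) →
  PendantCherry T x y z →
  (U' : LabGraph m) → Eliminates U (P zero) (P (suc zero)) U' →
  Displays U T ⇔ Displays U' T
lemma12 T U 3<m tree NU _ x y z x≢y x≢z y≢z P P-inj P₀~P₁ P₁~P₂ P₂~P₃ cut-x cut-y cut-z no-cut pendant U′ El =
  mk⇔ (λ E → let (E′ , avoids) = AvoidingEmbedding.avoiding-embedding NT NU x≢y x≢z y≢z shape spine E
             in displays-after-elimination NT NU El P₀~P₁ P₀-deg (SpineFacts.P₁-deg NU spine) E′ avoids)
      (displays-before-elimination NT NU El P₀~P₁ P₀-deg (SpineFacts.P₁-deg NU spine))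
  where
    NT = proj₁ tree
    shape = pendant-cherry-shape tree x≢y x≢z y≢z 3<m pendant
    distinct : ∀ {i j} → i ≢ j → P i ≢ P j
    distinct i≢j e = i≢j (P-inj e)
    P₀-deg = non-cut-edge⇒deg≡3 NU (distinct λ ()) P₀~P₁ (no-cut zero (suc zero))
    spine : Spine U x y z
    spine = record
      { P₀ = P zero ; P₁ = P (suc zero) ; P₂ = P (suc (suc zero)) ; P₃ = P (suc (suc (suc zero)))
      ; P₀≢P₁ = distinct λ () ; P₀≢P₂ = distinct λ () ; P₁≢P₂ = distinct λ () ; P₁≢P₃ = distinct λ ()
      ; P₂≢P₃ = distinct λ ()
      ; P₀~P₁ = P₀~P₁ ; P₁~P₂ = P₁~P₂ ; P₂~P₃ = P₂~P₃
      ; P₁~x = proj₁ cut-x ; P₂~y = proj₁ cut-y ; P₃~z = proj₁ cut-z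
      ; P₀-deg = P₀-deg
      }
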